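{- Let $G$ be a finite simple graph. Then $G$ is a blue-red interval graph if and only if $G$ is a linear leaf power.
   Context: An interval model of a graph $G$ is a family $(I_v)_{v\in V(G)}$ of closed intervals of $\mathbb{Q}$ such that for distinct $u,v$, $I_u\cap I_v\neq\emptyset$ iff $uv\in E(G)$. A graph $G$ is a blue-red interval graph if there exist a bipartition $(B,R)$ of $V(G)$ and a family of closed intervals $(I_v)_{v\in V(G)}$ of $\mathbb{Q}$ such that $E(G)=\{b_1b_2 : b_1,b_2\in B,\ b_1\neq b_2,\ I_{b_1}\cap I_{b_2}\neq\emptyset\}\cup\{rb : r\in R,\ b\in B,\ I_r\subseteq I_b\}$ (in particular $R$ is an independent set). A leaf root of $G$ is a pair $(T,\mathsf{w})$ where $T$ is a tree whose set of leaves is exactly $V(G)$ and $\mathsf{w}:E(T)\to[0,1]\cap\mathbb{Q}$ is an edge weighting, such that for distinct $u,v\in V(G)$, $uv\in E(G)$ iff $d_T(u,v)\le 1$, where $d_T(u,v)$ is the sum of the weights of the edges on the unique $u$–$v$ path in $T$. A caterpillar is a tree having a path that contains all nodes of degree at least $2$. A graph is a linear leaf power if it admits a leaf root $(T,\mathsf{w})$ with $T$ a caterpillar. -}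

module Defs where

open import Data.Nat using (ℕ; _≤_)
open import Data.Bool using (Bool; true; false)
open import Data.Fin using (Fin)
open import Data.List using (List; []; _∷_; length)
open import Data.List.Membership.Propositional using (_∈_)
open import Data.List.Relation.Unary.Unique.Propositional using (Unique)
open import Data.Product using (Σ; ∃; _×_; _,_)
open import Data.Sum using (_⊎_)
open import Data.Rational as ℚ using (ℚ; 0ℚ; 1ℚ)
open import Relation.Binary.PropositionalEquality using (_≡_; _≢_)
open import Relation.Nullary using (¬_)
open import Function.Bundles using (_⇔_)

record Graph (n : ℕ) : Set where
  field
    adj   : Fin n → Fin n → Bool
    sym   : ∀ u v → adj u v ≡ adj v u
    irrefl : ∀ v → adj v v ≡ false

  Edge : Fin n → Fin n → Set
  Edge u v = adj u v ≡ true

open Graph public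

record Interval : Set where
  constructor [_,_]⟨_⟩
  field
    lo : ℚ
    hi : ℚ
    lo≤hi : lo ℚ.≤ hi

open Interval public

_∈ᴵ_ : ℚ → Interval → Set
q ∈ᴵ I = (lo I ℚ.≤ q) × (q ℚ.≤ hi I)

Meets : Interval → Interval → Set
Meets I J = ∃ λ q → q ∈ᴵ I × q ∈ᴵ J

_⊆ᴵ_ : Interval → Interval → Set
I ⊆ᴵ J = ∀ q → q ∈ᴵ I → q ∈ᴵ J

-- Blue-red interval graphs.  The bipartition (B , R) is given by a
-- colouring: blue v ≡ true means v ∈ B, blue v ≡ false means v ∈ R.

IsBlueRedModel : ∀ {n} → Graph n → (Fin n → Bool) → (Fin n → Interval) → Set
IsBlueRedModel {n} G blue I =
  ∀ (u v : Fin n) → u ≢ v →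
    Edge G u v ⇔
      ( (blue u ≡ true × blue v ≡ true × Meets (I u) (I v))
      ⊎ (blue u ≡ false × blue v ≡ true × (I u ⊆ᴵ I v))
      ⊎ (blue u ≡ true × blue v ≡ false × (I v ⊆ᴵ I u)) )

IsBlueRedIntervalGraph : ∀ {n} → Graph n → Set
IsBlueRedIntervalGraph {n} G =
  ∃ λ (blue : Fin n → Bool) → ∃ λ (I : Fin n → Interval) → IsBlueRedModel G blue I

data Walk {m : ℕ} (G : Graph m) : Fin m → Fin m → List (Fin m) → Set where
  here : ∀ {u} → Walk G u u (u ∷ [])
  step : ∀ {u x v xs} → Edge G u x → Walk G x v xs → Walk G u v (u ∷ xs)

IsPath : ∀ {m} → Graph m → Fin m → Fin m → List (Fin m) → Set
IsPath G u v xs = Walk G u v xs × Unique xs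

HasCycle : ∀ {m} → Graph m → Set
HasCycle {m} G =
  ∃ λ (u : Fin m) → ∃ λ (v : Fin m) → ∃ λ (xs : List (Fin m)) →
    IsPath G u v xs × (3 ≤ length xs) × Edge G v u

Connected : ∀ {m} → Graph m → Set
Connected {m} G = ∀ (u v : Fin m) → ∃ λ xs → IsPath G u v xs

IsTree : ∀ {m} → Graph m → Set
IsTree G = Connected G × ¬ HasCycle G

DegAtLeast2 : ∀ {m} → Graph m → Fin m → Set
DegAtLeast2 {m} G x = ∃ λ (a : Fin m) → ∃ λ (b : Fin m) → Edge G x a × Edge G x b × a ≢ b

IsLeaf : ∀ {m} → Graph m → Fin m → Set
IsLeaf G x = ¬ DegAtLeast2 G x

IsCaterpillar : ∀ {m} → Graph m → Set
IsCaterpillar {m} G =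
  IsTree G ×
  ∃ λ (xs : List (Fin m)) →
    (xs ≡ [] ⊎ ∃ λ u → ∃ λ v → IsPath G u v xs) ×
    (∀ x → DegAtLeast2 G x → x ∈ xs)

listWeight : ∀ {m} → (Fin m → Fin m → ℚ) → List (Fin m) → ℚ
listWeight w (x ∷ y ∷ xs) = w x y ℚ.+ listWeight w (y ∷ xs)
listWeight w _ = 0ℚ

-- weighting w : E(T) → [0,1] ∩ ℚ (stored as a symmetric function on
-- pairs; values off edges are irrelevant)
IsWeighting : ∀ {m} → Graph m → (Fin m → Fin m → ℚ) → Set
IsWeighting {m} T w =
  (∀ (a b : Fin m) → w a b ≡ w b a) ×
  (∀ (a b : Fin m) → Edge T a b → (0ℚ ℚ.≤ w a b) × (w a b ℚ.≤ 1ℚ))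

-- d_T(x,y) ≤ 1, where d_T is the weight of the unique x–y path in T
DistAtMost1 : ∀ {m} → Graph m → (Fin m → Fin m → ℚ) → Fin m → Fin m → Set
DistAtMost1 T w x y = ∃ λ xs → IsPath T x y xs × (listWeight w xs ℚ.≤ 1ℚ)

-- (T , w) is a leaf root of G, where the vertices of G are identified
-- with the leaves of T via the injection ι
IsLeafRoot : ∀ {n m} → Graph n → Graph m → (Fin n → Fin m) → (Fin m → Fin m → ℚ) → Set
IsLeafRoot {n} {m} G T ι w =
  IsTree T ×
  (∀ (u v : Fin n) → ι u ≡ ι v → u ≡ v) ×
  (∀ (x : Fin m) → IsLeaf T x ⇔ (∃ λ (v : Fin n) → ι v ≡ x)) ×
  IsWeighting T w ×
  (∀ (u v : Fin n) → u ≢ v → Edge G u v ⇔ DistAtMost1 T w (ι u) (ι v))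

IsLinearLeafPower : ∀ {n} → Graph n → Set
IsLinearLeafPower {n} G =
  ∃ λ (m : ℕ) → ∃ λ (T : Graph m) → ∃ λ (ι : Fin n → Fin m) → ∃ λ (w : Fin m → Fin m → ℚ) →
    IsLeafRoot G T ι w × IsCaterpillar T

{-# OPTIONS --safe #-}
module Submission where

-- Lay the spine of a caterpillar out on ℚ, so that every leaf x hangs at weight a(x) above the spine
-- point P(x); the tree distance between two leaves is then a(x) + a(y) + |P(x) − P(y)|.  Turn a leaf
-- with a ≤ ½ into the blue interval of radius ½ − a around P, and a leaf with a > ½ into the red
-- interval of radius a − ½.  Then "the intervals meet" for two blue leaves, "the red interval lies in
-- the blue one" for a red and a blue leaf, and "never" for two red leaves are each equivalent to
-- a(x) + a(y) + |P(x) − P(y)| ≤ 1.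
-- Conversely, in a blue–red model replace every endpoint by its rank among all endpoints and widen
-- each interval by a quarter on both sides: no intersection or containment changes, and every radius
-- becomes positive.  Scaled down by a small ε, these intervals are read back as leaves hanging from a
-- path whose nodes sit at the possible centres.

open import Defs hiding (sym)
open import Data.Nat using (ℕ; suc)
open import Data.Fin using (Fin; toℕ)
open import Data.Rational using (ℚ; 0ℚ; 1ℚ) renaming (_≤_ to _≤ℚ_)
open import Data.Product using (∃; ∃₂)
open import Relation.Binary.PropositionalEquality using (_≡_; _≢_)
open import Function.Bundles using (_⇔_; mk⇔; Equivalence)

module RationalOrder where

  open import Data.Rational using (0ℚ; _+_; _-_; -_; ∣_∣; _≤_; _<_)
  open import Data.Rational.Properties
  open import Data.Rational.Solver using (module +-*-Solver)
  open import Relation.Binary.PropositionalEquality using (_≡_; refl; cong; subst; subst₂; sym; trans)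
  open import Relation.Nullary using (¬_)
  open +-*-Solver

  p≤q⇒0≤q-p : ∀ {p q} → p ≤ q → 0ℚ ≤ q - p
  p≤q⇒0≤q-p {p} {q} p≤q = subst (_≤ q - p) (+-inverseʳ p) (+-monoˡ-≤ (- p) p≤q)

  p<q⇒0<q-p : ∀ {p q} → p < q → 0ℚ < q - p
  p<q⇒0<q-p {p} {q} p<q = subst (_< q - p) (+-inverseʳ p) (+-monoˡ-< (- p) p<q)

  private
    p+[q-p]≡q : ∀ p q → p + (q - p) ≡ q
    p+[q-p]≡q = solve 2 (λ p q → p :+ (q :- p) := q) refl

  0≤q-p⇒p≤q : ∀ {p q} → 0ℚ ≤ q - p → p ≤ q
  0≤q-p⇒p≤q {p} {q} h = subst₂ _≤_ (+-identityʳ p) (p+[q-p]≡q p q) (+-monoʳ-≤ p h)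

  0<q-p⇒p<q : ∀ {p q} → 0ℚ < q - p → p < q
  0<q-p⇒p<q {p} {q} h = subst₂ _<_ (+-identityʳ p) (p+[q-p]≡q p q) (+-monoʳ-< p h)

  ≤-byDifference : ∀ {p q} e → q - p ≡ e → 0ℚ ≤ e → p ≤ q
  ≤-byDifference e eq 0≤e = 0≤q-p⇒p≤q (subst (0ℚ ≤_) (sym eq) 0≤e)

  <-byDifference : ∀ {p q} e → q - p ≡ e → 0ℚ < e → p < q
  <-byDifference e eq 0<e = 0<q-p⇒p<q (subst (0ℚ <_) (sym eq) 0<e)

  <⇒≱ : ∀ {p q} → p < q → ¬ (q ≤ p)
  <⇒≱ p<q q≤p = <-irrefl refl (<-≤-trans p<q q≤p)

  ∣p-q∣≡∣q-p∣ : ∀ p q → ∣ p - q ∣ ≡ ∣ q - p ∣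
  ∣p-q∣≡∣q-p∣ p q = trans (sym (∣-p∣≡∣p∣ (p - q)))
    (cong ∣_∣ (solve 2 (λ p q → :- (p :- q) := q :- p) refl p q))

  p≤q⇒∣p-q∣≡q-p : ∀ {p q} → p ≤ q → ∣ p - q ∣ ≡ q - p
  p≤q⇒∣p-q∣≡q-p {p} {q} p≤q = trans (∣p-q∣≡∣q-p∣ p q) (0≤p⇒∣p∣≡p (p≤q⇒0≤q-p p≤q))

  q≤p⇒∣p-q∣≡p-q : ∀ {p q} → q ≤ p → ∣ p - q ∣ ≡ p - q
  q≤p⇒∣p-q∣≡p-q q≤p = 0≤p⇒∣p∣≡p (p≤q⇒0≤q-p q≤p)

module Intervals where

  open import Data.Bool using (Bool; true; false)
  open import Data.Rational using (_≤_)
  open import Data.Rational.Properties using (≤-refl; ≤-trans; ≤-total)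
  open import Data.Product using (_×_; _,_; proj₁; proj₂)
  open import Data.Sum using (_⊎_; inj₁; inj₂)
  open import Relation.Binary.PropositionalEquality using (_≡_; refl)
  open import Relation.Nullary using (¬_)

  meets⇔ : ∀ I J → Meets I J ⇔ (lo I ≤ hi J × lo J ≤ hi I)
  meets⇔ I J = mk⇔ to from
    where
    to : Meets I J → lo I ≤ hi J × lo J ≤ hi I
    to (q , (lo≤q , q≤hi) , (lo′≤q , q≤hi′)) = ≤-trans lo≤q q≤hi′ , ≤-trans lo′≤q q≤hi
    from : lo I ≤ hi J × lo J ≤ hi I → Meets I J
    from (lo≤hi′ , lo′≤hi) with ≤-total (lo I) (lo J)
    ... | inj₁ lo≤lo′ = lo J , (lo≤lo′ , lo′≤hi) , (≤-refl , lo≤hi J)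
    ... | inj₂ lo′≤lo = lo I , (≤-refl , lo≤hi I) , (lo′≤lo , lo≤hi′)

  ⊆ᴵ⇔ : ∀ I J → I ⊆ᴵ J ⇔ (lo J ≤ lo I × hi I ≤ hi J)
  ⊆ᴵ⇔ I J = mk⇔
    (λ I⊆J → proj₁ (I⊆J (lo I) (≤-refl , lo≤hi I)) , proj₂ (I⊆J (hi I) (lo≤hi I , ≤-refl)))
    (λ (lo′≤lo , hi≤hi′) q (lo≤q , q≤hi) → ≤-trans lo′≤lo lo≤q , ≤-trans q≤hi hi≤hi′)

  BlueRedRelated : Bool → Bool → Interval → Interval → Set
  BlueRedRelated bu bv Iu Iv =
      (bu ≡ true  × bv ≡ true  × Meets Iu Iv)
    ⊎ (bu ≡ false × bv ≡ true  × Iu ⊆ᴵ Iv)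
    ⊎ (bu ≡ true  × bv ≡ false × Iv ⊆ᴵ Iu)

  blueRedRelated-sym : ∀ {bu bv} Iu Iv → BlueRedRelated bu bv Iu Iv → BlueRedRelated bv bu Iv Iu
  blueRedRelated-sym _ _ (inj₁ (bu , bv , (q , q∈u , q∈v))) = inj₁ (bv , bu , (q , q∈v , q∈u))
  blueRedRelated-sym _ _ (inj₂ (inj₁ (bu , bv , u⊆v)))      = inj₂ (inj₂ (bv , bu , u⊆v))
  blueRedRelated-sym _ _ (inj₂ (inj₂ (bu , bv , v⊆u)))      = inj₂ (inj₁ (bv , bu , v⊆u))

  relatedᵇᵇ : ∀ I J → BlueRedRelated true true I J ⇔ Meets I J
  relatedᵇᵇ _ _ = mk⇔ (λ { (inj₁ (_ , _ , m)) → m ; (inj₂ (inj₁ (() , _))) ; (inj₂ (inj₂ (_ , () , _))) })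
                  (λ m → inj₁ (refl , refl , m))

  relatedʳᵇ : ∀ I J → BlueRedRelated false true I J ⇔ I ⊆ᴵ J
  relatedʳᵇ _ _ = mk⇔ (λ { (inj₁ (() , _)) ; (inj₂ (inj₁ (_ , _ , s))) → s ; (inj₂ (inj₂ (() , _))) })
                  (λ s → inj₂ (inj₁ (refl , refl , s)))

  relatedᵇʳ : ∀ I J → BlueRedRelated true false I J ⇔ J ⊆ᴵ I
  relatedᵇʳ _ _ = mk⇔ (λ { (inj₁ (_ , () , _)) ; (inj₂ (inj₁ (() , _))) ; (inj₂ (inj₂ (_ , _ , s))) → s })
                  (λ s → inj₂ (inj₂ (refl , refl , s)))

  relatedʳʳ : ∀ I J → ¬ BlueRedRelated false false I J
  relatedʳʳ _ _ (inj₁ (() , _))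
  relatedʳʳ _ _ (inj₂ (inj₁ (_ , () , _)))
  relatedʳʳ _ _ (inj₂ (inj₂ (() , _)))

  blueRedRelated-cong : ∀ {bu bv Iu Iv Ju Jv} →
    Meets Iu Iv ⇔ Meets Ju Jv → Iu ⊆ᴵ Iv ⇔ Ju ⊆ᴵ Jv → Iv ⊆ᴵ Iu ⇔ Jv ⊆ᴵ Ju →
    BlueRedRelated bu bv Iu Iv ⇔ BlueRedRelated bu bv Ju Jv
  blueRedRelated-cong meets uv vu = mk⇔
    (λ { (inj₁ (p , q , r)) → inj₁ (p , q , Equivalence.to meets r)
       ; (inj₂ (inj₁ (p , q , r))) → inj₂ (inj₁ (p , q , Equivalence.to uv r))
       ; (inj₂ (inj₂ (p , q , r))) → inj₂ (inj₂ (p , q , Equivalence.to vu r)) })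
    (λ { (inj₁ (p , q , r)) → inj₁ (p , q , Equivalence.from meets r)
       ; (inj₂ (inj₁ (p , q , r))) → inj₂ (inj₁ (p , q , Equivalence.from uv r))
       ; (inj₂ (inj₂ (p , q , r))) → inj₂ (inj₂ (p , q , Equivalence.from vu r)) })

module LeafIntervals where

  open import Data.Bool using (Bool; true; false)
  open import Data.Rational using (ℚ; 0ℚ; 1ℚ; ½; _+_; _-_; ∣_∣; _≤_; _<_)
  open import Data.Rational.Properties using (≤-total; <⇒≤; +-mono-≤; +-mono-<-≤; +-comm)
  open import Data.Rational.Solver using (module +-*-Solver)
  open import Data.Product using (_×_; _,_; proj₁; proj₂)
  open import Data.Sum using (inj₁; inj₂)
  open import Relation.Nullary using (¬_)
  open import Data.Empty using (⊥-elim)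
  open import Function.Base using (_∘_)
  open import Function.Construct.Composition using (_⇔-∘_)
  open import Relation.Binary.PropositionalEquality using (_≡_; refl; cong₂; subst; sym)
  open +-*-Solver
  open RationalOrder
  open Intervals

  ball : (p h : ℚ) → 0ℚ ≤ h → Interval
  ball p h 0≤h = [ p - h , p + h ]⟨ ≤-byDifference (h + h)
    (solve 2 (λ p h → (p :+ h) :- (p :- h) := h :+ h) refl p h) (+-mono-≤ 0≤h 0≤h) ⟩

  -- A leaf hanging at weight a becomes an interval of radius |½ − a|, blue iff a ≤ ½.
  IsRadius : Bool → ℚ → ℚ → Set
  IsRadius true  a h = a ≡ ½ - h × 0ℚ ≤ h
  IsRadius false a h = a ≡ ½ + h × 0ℚ < h

  radius-nonNeg : ∀ b {a h} → IsRadius b a h → 0ℚ ≤ h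
  radius-nonNeg true  (_ , 0≤h) = 0≤h
  radius-nonNeg false (_ , 0<h) = <⇒≤ 0<h

  record LeafInterval : Set where
    constructor leafInterval
    field
      blue     : Bool
      weight   : ℚ
      radius   : ℚ
      centre   : ℚ
      isRadius : IsRadius blue weight radius

  open LeafInterval

  interval : LeafInterval → Interval
  interval l = ball (centre l) (radius l) (radius-nonNeg (blue l) (isRadius l))

  Related : LeafInterval → LeafInterval → Set
  Related u v = BlueRedRelated (blue u) (blue v) (interval u) (interval v)

  WithinOne : LeafInterval → LeafInterval → Set
  WithinOne u v = weight u + weight v + ∣ centre u - centre v ∣ ≤ 1ℚ

  private
    ≤⇔≤-sameSlack : ∀ {p q p′ q′} → q - p ≡ q′ - p′ → (p ≤ q) ⇔ (p′ ≤ q′)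
    ≤⇔≤-sameSlack eq = mk⇔ (λ p≤q → ≤-byDifference _ (sym eq) (p≤q⇒0≤q-p p≤q))
                            (λ p′≤q′ → ≤-byDifference _ eq (p≤q⇒0≤q-p p′≤q′))

    twice : ℚ → ℚ
    twice d = d + d

  -- Each relation between two intervals of radii hu, hv centred at pu ≤ pv comes down to a single
  -- endpoint inequality whose slack is exactly 1 − (weight u + weight v + (pv − pu)).
  module _ {pu pv hu hv : ℚ} (0≤hu : 0ℚ ≤ hu) (0≤hv : 0ℚ ≤ hv) (pu≤pv : pu ≤ pv) where

    private
      U V : Interval
      U = ball pu hu 0≤hu
      V = ball pv hv 0≤hv
      0≤pv-pu = p≤q⇒0≤q-p pu≤pv

    meets⇔withinOne : Meets U V ⇔ ((½ - hu) + (½ - hv) + (pv - pu) ≤ 1ℚ)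
    meets⇔withinOne = mk⇔ (λ m → to (proj₂ (Equivalence.to (meets⇔ U V) m)))
                          (λ c → Equivalence.from (meets⇔ U V) (loU≤hiV , from c))
      where
      closeness : (pv - hv ≤ pu + hu) ⇔ ((½ - hu) + (½ - hv) + (pv - pu) ≤ 1ℚ)
      closeness = ≤⇔≤-sameSlack (solve 4 (λ hu hv pu pv → (pu :+ hu) :- (pv :- hv)
        := con 1ℚ :- ((con ½ :- hu) :+ (con ½ :- hv) :+ (pv :- pu))) refl hu hv pu pv)
      open Equivalence closeness
      loU≤hiV : lo U ≤ hi V
      loU≤hiV = ≤-byDifference ((pv - pu) + hv + hu)
        (solve 4 (λ hu hv pu pv → (pv :+ hv) :- (pu :- hu) := (pv :- pu) :+ hv :+ hu) refl hu hv pu pv)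
        (+-mono-≤ (+-mono-≤ 0≤pv-pu 0≤hv) 0≤hu)

    ⊆ᴵ⇔withinOne : U ⊆ᴵ V ⇔ ((½ + hu) + (½ - hv) + (pv - pu) ≤ 1ℚ)
    ⊆ᴵ⇔withinOne = mk⇔ (λ s → to (proj₁ (Equivalence.to (⊆ᴵ⇔ U V) s)))
                       (λ c → Equivalence.from (⊆ᴵ⇔ U V) (from c , hiU≤hiV (p≤q⇒0≤q-p (from c))))
      where
      closeness : (pv - hv ≤ pu - hu) ⇔ ((½ + hu) + (½ - hv) + (pv - pu) ≤ 1ℚ)
      closeness = ≤⇔≤-sameSlack (solve 4 (λ hu hv pu pv → (pu :- hu) :- (pv :- hv)
        := con 1ℚ :- ((con ½ :+ hu) :+ (con ½ :- hv) :+ (pv :- pu))) refl hu hv pu pv)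
      open Equivalence closeness
      hiU≤hiV : 0ℚ ≤ (pu - hu) - (pv - hv) → hi U ≤ hi V
      hiU≤hiV 0≤slack = ≤-byDifference ((pu - hu) - (pv - hv) + twice (pv - pu))
        (solve 4 (λ hu hv pu pv → (pv :+ hv) :- (pu :+ hu) := (pu :- hu) :- (pv :- hv) :+ ((pv :- pu) :+ (pv :- pu))) refl hu hv pu pv)
        (+-mono-≤ 0≤slack (+-mono-≤ 0≤pv-pu 0≤pv-pu))

    ⊇ᴵ⇔withinOne : V ⊆ᴵ U ⇔ ((½ - hu) + (½ + hv) + (pv - pu) ≤ 1ℚ)
    ⊇ᴵ⇔withinOne = mk⇔ (λ s → to (proj₂ (Equivalence.to (⊆ᴵ⇔ V U) s)))
                       (λ c → Equivalence.from (⊆ᴵ⇔ V U) (loU≤loV (p≤q⇒0≤q-p (from c)) , from c))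
      where
      closeness : (pv + hv ≤ pu + hu) ⇔ ((½ - hu) + (½ + hv) + (pv - pu) ≤ 1ℚ)
      closeness = ≤⇔≤-sameSlack (solve 4 (λ hu hv pu pv → (pu :+ hu) :- (pv :+ hv)
        := con 1ℚ :- ((con ½ :- hu) :+ (con ½ :+ hv) :+ (pv :- pu))) refl hu hv pu pv)
      open Equivalence closeness
      loU≤loV : 0ℚ ≤ (pu + hu) - (pv + hv) → lo U ≤ lo V
      loU≤loV 0≤slack = ≤-byDifference ((pu + hu) - (pv + hv) + twice (pv - pu))
        (solve 4 (λ hu hv pu pv → (pv :- hv) :- (pu :- hu) := (pu :+ hu) :- (pv :+ hv) :+ ((pv :- pu) :+ (pv :- pu))) refl hu hv pu pv)
        (+-mono-≤ 0≤slack (+-mono-≤ 0≤pv-pu 0≤pv-pu))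

  redRed-notWithinOne : ∀ {pu pv hu hv} → 0ℚ < hu → 0ℚ < hv → pu ≤ pv →
                        ¬ ((½ + hu) + (½ + hv) + (pv - pu) ≤ 1ℚ)
  redRed-notWithinOne {pu} {pv} {hu} {hv} 0<hu 0<hv pu≤pv = <⇒≱ (<-byDifference (hu + hv + (pv - pu))
    (solve 4 (λ hu hv pu pv → ((con ½ :+ hu) :+ (con ½ :+ hv) :+ (pv :- pu)) :- con 1ℚ := hu :+ hv :+ (pv :- pu)) refl hu hv pu pv)
    (+-mono-<-≤ (+-mono-<-≤ 0<hu (<⇒≤ 0<hv)) (p≤q⇒0≤q-p pu≤pv)))

  private
    related⇔withinOne-ordered : ∀ u v → centre u ≤ centre v →
      Related u v ⇔ (weight u + weight v + (centre v - centre u) ≤ 1ℚ)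
    related⇔withinOne-ordered u@(leafInterval true  _ _ _ (refl , 0≤hu)) v@(leafInterval true  _ _ _ (refl , 0≤hv)) le =
      meets⇔withinOne 0≤hu 0≤hv le ⇔-∘ relatedᵇᵇ (interval u) (interval v)
    related⇔withinOne-ordered u@(leafInterval false _ _ _ (refl , 0<hu)) v@(leafInterval true  _ _ _ (refl , 0≤hv)) le =
      ⊆ᴵ⇔withinOne (<⇒≤ 0<hu) 0≤hv le ⇔-∘ relatedʳᵇ (interval u) (interval v)
    related⇔withinOne-ordered u@(leafInterval true  _ _ _ (refl , 0≤hu)) v@(leafInterval false _ _ _ (refl , 0<hv)) le =
      ⊇ᴵ⇔withinOne 0≤hu (<⇒≤ 0<hv) le ⇔-∘ relatedᵇʳ (interval u) (interval v)
    related⇔withinOne-ordered u@(leafInterval false _ _ _ (refl , 0<hu)) v@(leafInterval false _ _ _ (refl , 0<hv)) le =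
      mk⇔ (⊥-elim ∘ relatedʳʳ (interval u) (interval v)) (⊥-elim ∘ redRed-notWithinOne 0<hu 0<hv le)

    withinOne-ordered : ∀ u v → centre u ≤ centre v →
      (weight u + weight v + (centre v - centre u) ≤ 1ℚ) ⇔ WithinOne u v
    withinOne-ordered u v le = mk⇔ (subst P (sym distance)) (subst P distance)
      where
      P = λ d → weight u + weight v + d ≤ 1ℚ
      distance = p≤q⇒∣p-q∣≡q-p le

    withinOne-sym : ∀ u v → WithinOne u v → WithinOne v u
    withinOne-sym u v = subst (_≤ 1ℚ) (cong₂ _+_ (+-comm (weight u) (weight v)) (∣p-q∣≡∣q-p∣ (centre u) (centre v)))

  related⇔withinOne : ∀ u v → Related u v ⇔ WithinOne u v
  related⇔withinOne u v with ≤-total (centre u) (centre v)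
  ... | inj₁ pu≤pv = withinOne-ordered u v pu≤pv ⇔-∘ related⇔withinOne-ordered u v pu≤pv
  ... | inj₂ pv≤pu = mk⇔ (withinOne-sym v u ∘ to ∘ blueRedRelated-sym (interval u) (interval v))
                         (blueRedRelated-sym (interval v) (interval u) ∘ from ∘ withinOne-sym u v)
    where open Equivalence (withinOne-ordered v u pv≤pu ⇔-∘ related⇔withinOne-ordered v u pv≤pu)

module Walks where

  open import Data.Nat using (zero; suc; _≤_; _<_; _+_; s≤s)
  open import Data.Nat.Properties using (≤-refl; <⇒≤; m≤m+n; +-suc; +-identityʳ; ≤-<-trans; <⇒≱; <⇒≢; m≤n⇒m<n∨m≡n)
  open import Data.Fin using (Fin)
  open import Data.Fin.Properties using (_≟_)
  open import Data.List using (List; []; _∷_; length)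
  open import Data.List.Membership.Propositional using (_∈_)
  import Data.List.Membership.DecPropositional as DecMembership
  open import Data.List.Relation.Unary.Any using (here; there)
  open import Data.List.Relation.Unary.All using ([]; _∷_)
  open import Data.List.Relation.Unary.All as All using ()
  open import Data.List.Relation.Unary.All.Properties using (¬Any⇒All¬)
  open import Data.List.Relation.Unary.AllPairs using ([]; _∷_)
  open import Data.List.Relation.Unary.Unique.Propositional using (Unique)
  open import Data.Product using (∃; _×_; _,_; proj₂)
  open import Data.Sum using (inj₁; inj₂)
  open import Data.Empty using (⊥; ⊥-elim)
  open import Relation.Binary.PropositionalEquality using (_≡_; _≢_; refl; cong; subst; sym; trans)
  open import Relation.Nullary using (yes; no)

  module _ {m : ℕ} (T : Graph m) where

    open DecMembership (_≟_ {m}) using (_∈?_)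

    edge-sym : ∀ {x y} → Edge T x y → Edge T y x
    edge-sym {x} {y} e = trans (Graph.sym T y x) e

    edge-irrefl : ∀ {x} → Edge T x x → ⊥
    edge-irrefl {x} e with trans (sym e) (Graph.irrefl T x)
    ... | ()

    walk-last∈ : ∀ {x v xs} → Walk T x v xs → v ∈ xs
    walk-last∈ here       = here refl
    walk-last∈ (step _ w) = there (walk-last∈ w)

    walk-head : ∀ {u v xs} → Walk T u v xs → ∃ λ ys → xs ≡ u ∷ ys
    walk-head here       = _ , refl
    walk-head (step _ _) = _ , refl

    walk-firstEdge : ∀ {u v x xs} → Walk T u v (u ∷ x ∷ xs) → Edge T u x
    walk-firstEdge (step e here)       = e
    walk-firstEdge (step e (step _ _)) = e

    penultimate : ∀ {x y v ys} → Edge T x y → Walk T y v ys → ∃ λ p → Edge T p v × p ∈ x ∷ ys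
    penultimate e here = _ , e , here refl
    penultimate _ (step e w) with penultimate e w
    ... | p , p~v , p∈ = p , p~v , there p∈

    walk-++ : ∀ {u v y xs ys} → Walk T u v xs → Walk T v y ys → ∃ (Walk T u y)
    walk-++ here        w₂ = _ , w₂
    walk-++ (step e w₁) w₂ = _ , step e (proj₂ (walk-++ w₁ w₂))

    walk-reverse : ∀ {u v xs} → Walk T u v xs → ∃ (Walk T v u)
    walk-reverse here       = _ , here
    walk-reverse (step e w) = walk-++ (proj₂ (walk-reverse w)) (step (edge-sym e) here)

    path-suffix : ∀ {x a v ys} → x ∈ ys → IsPath T a v ys → ∃ (IsPath T x v)
    path-suffix (here refl) (here , uq)         = _ , here , uq
    path-suffix (here refl) (step e w , uq)     = _ , step e w , uq
    path-suffix (there x∈)  (step _ w , _ ∷ uq) = path-suffix x∈ (w , uq)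

    walk⇒path : ∀ {u v xs} → Walk T u v xs → ∃ (IsPath T u v)
    walk⇒path here = _ , here , [] ∷ []
    walk⇒path {u} (step e w) with walk⇒path w
    ... | ys , w′ , uq with u ∈? ys
    ...   | yes u∈ = path-suffix u∈ (w′ , uq)
    ...   | no  u∉ = u ∷ ys , step e w′ , ¬Any⇒All¬ ys u∉ ∷ uq

  module Segments {m : ℕ} (T : Graph m) (s : ℕ → Fin m) (k : ℕ)
    (s-edge : ∀ t → suc t < k → Edge T (s t) (s (suc t)))
    (s-injective : ∀ t t′ → t < k → t′ < k → s t ≡ s t′ → t ≡ t′) where

    segment : ℕ → ℕ → List (Fin m)
    segment i zero    = s i ∷ []
    segment i (suc l) = s i ∷ segment (suc i) l

    length-segment : ∀ i l → length (segment i l) ≡ suc l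
    length-segment i zero    = refl
    length-segment i (suc l) = cong suc (length-segment (suc i) l)

    ∈-segment⁻ : ∀ i l {y} → y ∈ segment i l → ∃ λ t → i ≤ t × t ≤ i + l × y ≡ s t
    ∈-segment⁻ i zero    (here refl) = i , ≤-refl , m≤m+n i 0 , refl
    ∈-segment⁻ i (suc l) (here refl) = i , ≤-refl , m≤m+n i _ , refl
    ∈-segment⁻ i (suc l) (there y∈) with ∈-segment⁻ (suc i) l y∈
    ... | t , i<t , t≤ , refl = t , <⇒≤ i<t , subst (t ≤_) (sym (+-suc i l)) t≤ , refl

    ∈-segment⁺ : ∀ i l t → i ≤ t → t ≤ i + l → s t ∈ segment i l
    ∈-segment⁺ i l t i≤t t≤ with m≤n⇒m<n∨m≡n i≤t
    ∈-segment⁺ i zero    t i≤t t≤ | inj₂ refl = here refl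
    ∈-segment⁺ i (suc l) t i≤t t≤ | inj₂ refl = here refl
    ∈-segment⁺ i zero    t i≤t t≤ | inj₁ i<t  = ⊥-elim (<⇒≱ i<t (subst (t ≤_) (+-identityʳ i) t≤))
    ∈-segment⁺ i (suc l) t i≤t t≤ | inj₁ i<t  = there (∈-segment⁺ (suc i) l t i<t (subst (t ≤_) (+-suc i l) t≤))

    segment-walk : ∀ i l → i + l < k → Walk T (s i) (s (i + l)) (segment i l)
    segment-walk i zero    _ = subst (λ t → Walk T (s i) (s t) (s i ∷ [])) (sym (+-identityʳ i)) here
    segment-walk i (suc l) lt =
      step (s-edge i (≤-<-trans (s≤s (m≤m+n i l)) lt′))
           (subst (λ t → Walk T (s (suc i)) (s t) (segment (suc i) l)) (sym (+-suc i l)) (segment-walk (suc i) l lt′))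
      where lt′ = subst (_< k) (+-suc i l) lt

    segment-unique : ∀ i l → i + l < k → Unique (segment i l)
    segment-unique i zero    _  = [] ∷ []
    segment-unique i (suc l) lt = All.tabulate fresh ∷ segment-unique (suc i) l lt′
      where
      lt′ = subst (_< k) (+-suc i l) lt
      fresh : ∀ {y} → y ∈ segment (suc i) l → s i ≢ y
      fresh y∈ eq with ∈-segment⁻ (suc i) l y∈
      ... | t , i<t , t≤ , refl = <⇒≢ i<t (s-injective i t (≤-<-trans (m≤m+n i (suc l)) lt) (≤-<-trans t≤ lt′) eq)

module CaterpillarLayouts where

  open import Data.Nat using (suc; _+_; pred; s≤s)
  open import Data.Nat.Properties using (suc-injective; +-suc; +-comm; +-identityʳ; m+1+n≢m)
  open import Data.Fin using (Fin)
  open import Data.List using (List; []; _∷_; length)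
  open import Data.List.Relation.Unary.Any using (here; there)
  open import Data.List.Relation.Unary.All as All using ()
  open import Data.List.Relation.Unary.AllPairs using (_∷_)
  open import Data.List.Relation.Unary.Unique.Propositional using (Unique)
  open import Data.Product using (∃; _×_; _,_; proj₁; proj₂)
  open import Data.Sum using (_⊎_; inj₁; inj₂)
  open import Data.Unit using (⊤)
  open import Data.Empty using (⊥; ⊥-elim)
  open import Data.Rational using (ℚ; 0ℚ; 1ℚ; _-_; ∣_∣) renaming (_+_ to _+ℚ_; _≤_ to _≤ℚ_)
  open import Data.Rational.Properties using (≤-reflexive; ≤-trans; +-inverseʳ; +-assoc)
  open import Data.Rational.Solver using (module +-*-Solver)
  open import Relation.Binary.PropositionalEquality using (_≡_; _≢_; refl; cong; cong₂; subst; sym; trans)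
  open import Relation.Binary.PropositionalEquality.Properties using (module ≡-Reasoning)
  open import Relation.Nullary using (¬_; Dec; yes; no)
  open +-*-Solver
  open RationalOrder
  open Walks

  -- Spine nodes carry consecutive indices and positions whose differences are the spine weights;
  -- every other node x hangs at weight hang x above the spine position foot x.  Two adjacent
  -- non-spine nodes (T a single edge) share the weight of their edge.
  record CaterpillarLayout {m : ℕ} (T : Graph m) (w : Fin m → Fin m → ℚ) : Set₁ where
    field
      Spine                 : Fin m → Set
      spine?                : ∀ x → Dec (Spine x)
      offSpine-isLeaf       : ∀ x → ¬ Spine x → IsLeaf T x
      index                 : Fin m → ℕ
      index-injective       : ∀ {x y} → Spine x → Spine y → index x ≡ index y → x ≡ y
      spineEdge-consecutive : ∀ {x y} → Spine x → Spine y → Edge T x y →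
                              suc (index x) ≡ index y ⊎ suc (index y) ≡ index x
      position              : Fin m → ℚ
      spineEdge-weight      : ∀ {x y} → Spine x → Spine y → Edge T x y → suc (index x) ≡ index y →
                              w x y ≡ position y - position x
      hang foot             : Fin m → ℚ
      hang-fromSpine        : ∀ {x s} → ¬ Spine x → Spine s → Edge T x s → w x s ≡ hang x × foot x ≡ position s
      hang-fromLeaf         : ∀ {x y} → ¬ Spine x → ¬ Spine y → Edge T x y → w x y ≡ hang x +ℚ hang y × foot x ≡ foot y
      weight-sym            : ∀ x y → w x y ≡ w y x
      weight-nonNeg         : ∀ x y → Edge T x y → 0ℚ ≤ℚ w x y

  data Direction : Set where
    ascending descending : Direction

  Step : Direction → ℕ → ℕ → Set
  Step ascending  i j = suc i ≡ j
  Step descending i j = suc j ≡ i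

  module CaterpillarLayoutProperties {m : ℕ} {T : Graph m} {w : Fin m → Fin m → ℚ} (L : CaterpillarLayout T w) where

    open CaterpillarLayout L

    twoNeighbours⇒spine : ∀ {z p q} → Edge T z p → Edge T z q → p ≢ q → Spine z
    twoNeighbours⇒spine {z} z~p z~q p≢q with spine? z
    ... | yes sz = sz
    ... | no ¬sz = ⊥-elim (offSpine-isLeaf z ¬sz (_ , _ , z~p , z~q , p≢q))

    spineStep : ∀ {z n} → Spine z → Spine n → Edge T z n → ∃ λ d → Step d (index z) (index n)
    spineStep sz sn z~n with spineEdge-consecutive sz sn z~n
    ... | inj₁ st = ascending , st
    ... | inj₂ st = descending , st

    step-persists : ∀ {z n n′} d → Spine z → Spine n → Spine n′ → Edge T n n′ → z ≢ n′ →
                    Step d (index z) (index n) → Step d (index n) (index n′)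
    step-persists ascending sz sn sn′ n~n′ z≢n′ st with spineEdge-consecutive sn sn′ n~n′
    ... | inj₁ st′ = st′
    ... | inj₂ st′ = ⊥-elim (z≢n′ (index-injective sz sn′ (suc-injective (trans st (sym st′)))))
    step-persists descending sz sn sn′ n~n′ z≢n′ st with spineEdge-consecutive sn sn′ n~n′
    ... | inj₁ st′ = ⊥-elim (z≢n′ (index-injective sz sn′ (trans (sym st) st′)))
    ... | inj₂ st′ = st′

    StartsIn : Direction → List (Fin m) → Set
    StartsIn d (z ∷ n ∷ _) = Spine n → Step d (index z) (index n)
    StartsIn d _           = ⊤

    private
      -- The interior nodes of a path are on the spine, and they keep the direction of the first step.
      continuesAlongSpine : ∀ {z n n′ v ys} d → Spine z → Edge T z n → Walk T n v (n ∷ n′ ∷ ys) →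
                            Unique (z ∷ n ∷ n′ ∷ ys) →
                 StartsIn d (z ∷ n ∷ n′ ∷ ys) → Spine n × StartsIn d (n ∷ n′ ∷ ys) × Step d (index z) (index n)
      continuesAlongSpine d sz z~n wn (z∉ ∷ _) starts =
        sn , (λ sn′ → step-persists d sz sn sn′ n~n′ z≢n′ (starts sn)) , starts sn
        where
        z≢n′ = All.lookup z∉ (there (here refl))
        n~n′ = walk-firstEdge T wn
        sn   = twoNeighbours⇒spine (edge-sym T z~n) n~n′ z≢n′

      addZero≡addDifference : ∀ {u v p q} → u ≡ v → p ≡ q → u +ℚ 0ℚ ≡ v +ℚ (p - q)
      addZero≡addDifference {u} {p = p} refl refl = solve 2 (λ u p → u :+ con 0ℚ := u :+ (p :- p)) refl u p

      telescopeᵃ : ∀ p q a f → (q - p) +ℚ (a +ℚ (f - q)) ≡ a +ℚ (f - p)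
      telescopeᵃ = solve 4 (λ p q a f → (q :- p) :+ (a :+ (f :- q)) := a :+ (f :- p)) refl

      telescopeᵈ : ∀ p q a f → (p - q) +ℚ (a +ℚ (q - f)) ≡ a +ℚ (p - f)
      telescopeᵈ = solve 4 (λ p q a f → (p :- q) :+ (a :+ (q :- f)) := a :+ (p :- f)) refl

    DistanceToLeaf : Direction → Fin m → Fin m → List (Fin m) → Set
    DistanceToLeaf ascending  z y xs = position z ≤ℚ foot y × listWeight w xs ≡ hang y +ℚ (foot y - position z)
    DistanceToLeaf descending z y xs = foot y ≤ℚ position z × listWeight w xs ≡ hang y +ℚ (position z - foot y)

    open ≡-Reasoning

    spineToLeaf-distance : ∀ {z y xs} → Spine z → ¬ Spine y → Walk T z y xs → Unique xs →
                           ∀ d → StartsIn d xs → DistanceToLeaf d z y xs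
    spineToLeaf-distance sz ¬sy here _ _ _ = ⊥-elim (¬sy sz)
    spineToLeaf-distance {z} {y} sz ¬sy (step z~y here) _ d _ = oneStep d
      where
      hangs = hang-fromSpine ¬sy sz (edge-sym T z~y)
      w≡hang : w z y ≡ hang y
      w≡hang = trans (weight-sym z y) (proj₁ hangs)
      oneStep : ∀ d → DistanceToLeaf d z y (z ∷ y ∷ [])
      oneStep ascending  = ≤-reflexive (sym (proj₂ hangs)) , addZero≡addDifference w≡hang (proj₂ hangs)
      oneStep descending = ≤-reflexive (proj₂ hangs) , addZero≡addDifference w≡hang (sym (proj₂ hangs))
    spineToLeaf-distance {z} {y} sz ¬sy (step {x = n} z~n wn@(step {x = n′} _ w′)) uq@(_ ∷ uq′) d starts
      with walk-head T w′
    ... | ys , refl = extend d (continuesAlongSpine d sz z~n wn uq starts)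
      where
      rest = spineToLeaf-distance
      extend : ∀ d → Spine n × StartsIn d (n ∷ n′ ∷ ys) × Step d (index z) (index n) →
               DistanceToLeaf d z y (z ∷ n ∷ n′ ∷ ys)
      extend ascending (sn , starts′ , st) with rest sn ¬sy wn uq′ ascending starts′
      ... | pn≤fy , eq = ≤-trans (≤-byDifference _ (sym w≡) (weight-nonNeg z n z~n)) pn≤fy ,
                          trans (cong₂ _+ℚ_ w≡ eq) (telescopeᵃ (position z) (position n) (hang y) (foot y))
        where w≡ = spineEdge-weight sz sn z~n st
      extend descending (sn , starts′ , st) with rest sn ¬sy wn uq′ descending starts′
      ... | fy≤pn , eq = ≤-trans fy≤pn (≤-byDifference _ (sym w≡) (weight-nonNeg z n z~n)) ,
                          trans (cong₂ _+ℚ_ w≡ eq) (telescopeᵈ (position z) (position n) (hang y) (foot y))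
        where w≡ = trans (weight-sym z n) (spineEdge-weight sn sz (edge-sym T z~n) st)

    leafToLeaf-distance : ∀ {x y xs} → ¬ Spine x → ¬ Spine y → x ≢ y → IsPath T x y xs →
                          listWeight w xs ≡ hang x +ℚ hang y +ℚ ∣ foot x - foot y ∣
    leafToLeaf-distance _ _ x≢y (here , _) = ⊥-elim (x≢y refl)
    leafToLeaf-distance {x} {y} ¬sx ¬sy _ (step x~y here , _) =
      cong₂ _+ℚ_ (proj₁ hangs) (sym (cong ∣_∣ (trans (cong (_- foot y) (proj₂ hangs)) (+-inverseʳ (foot y)))))
      where hangs = hang-fromLeaf ¬sx ¬sy x~y
    leafToLeaf-distance {x} {y} ¬sx ¬sy _ (step {x = z} x~z wz@(step {x = n} _ w′) , (x∉ ∷ uq)) with walk-head T w′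
    ... | ys , refl = combine (firstDirection (spine? n))
      where
      sz = twoNeighbours⇒spine (edge-sym T x~z) (walk-firstEdge T wz) (All.lookup x∉ (there (here refl)))
      hangs = hang-fromSpine ¬sx sz x~z
      w≡hang = proj₁ hangs
      foot≡ = proj₂ hangs
      firstDirection : Dec (Spine n) → ∃ λ d → StartsIn d (z ∷ n ∷ ys)
      firstDirection (yes sn) = proj₁ (spineStep sz sn (walk-firstEdge T wz)) , λ _ → proj₂ (spineStep sz sn (walk-firstEdge T wz))
      firstDirection (no ¬sn) = ascending , λ sn → ⊥-elim (¬sn sn)
      combine : ∃ (λ d → StartsIn d (z ∷ n ∷ ys)) →
                listWeight w (x ∷ z ∷ n ∷ ys) ≡ hang x +ℚ hang y +ℚ ∣ foot x - foot y ∣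
      combine (ascending , starts) with spineToLeaf-distance sz ¬sy wz uq ascending starts
      ... | pz≤fy , eq = begin
        w x z +ℚ listWeight w (z ∷ n ∷ ys)              ≡⟨ cong₂ _+ℚ_ w≡hang eq ⟩
        hang x +ℚ (hang y +ℚ (foot y - position z))     ≡⟨ sym (+-assoc (hang x) (hang y) _) ⟩
        hang x +ℚ hang y +ℚ (foot y - position z)       ≡⟨ cong (λ p → hang x +ℚ hang y +ℚ (foot y - p)) (sym foot≡) ⟩
        hang x +ℚ hang y +ℚ (foot y - foot x)           ≡⟨ cong (hang x +ℚ hang y +ℚ_) (sym (p≤q⇒∣p-q∣≡q-p fx≤fy)) ⟩
        hang x +ℚ hang y +ℚ ∣ foot x - foot y ∣         ∎
        where fx≤fy = subst (_≤ℚ foot y) (sym foot≡) pz≤fy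
      combine (descending , starts) with spineToLeaf-distance sz ¬sy wz uq descending starts
      ... | fy≤pz , eq = begin
        w x z +ℚ listWeight w (z ∷ n ∷ ys)              ≡⟨ cong₂ _+ℚ_ w≡hang eq ⟩
        hang x +ℚ (hang y +ℚ (position z - foot y))     ≡⟨ sym (+-assoc (hang x) (hang y) _) ⟩
        hang x +ℚ hang y +ℚ (position z - foot y)       ≡⟨ cong (λ p → hang x +ℚ hang y +ℚ (p - foot y)) (sym foot≡) ⟩
        hang x +ℚ hang y +ℚ (foot x - foot y)           ≡⟨ cong (hang x +ℚ hang y +ℚ_) (sym (q≤p⇒∣p-q∣≡p-q fy≤fx)) ⟩
        hang x +ℚ hang y +ℚ ∣ foot x - foot y ∣         ∎
        where fy≤fx = subst (foot y ≤ℚ_) (sym foot≡) fy≤pz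

    IndexShift : Direction → Fin m → Fin m → ℕ → Set
    IndexShift ascending  z v k = index z + k ≡ index v
    IndexShift descending z v k = index v + k ≡ index z

    spineToSpine-index : ∀ {z v xs} → Spine z → Spine v → Walk T z v xs → Unique xs →
                         ∀ d → StartsIn d xs → IndexShift d z v (pred (length xs))
    spineToSpine-index _ _ here _ ascending  _ = +-identityʳ _
    spineToSpine-index _ _ here _ descending _ = +-identityʳ _
    spineToSpine-index _ sv (step _ here) _ ascending  starts = trans (+-comm _ 1) (starts sv)
    spineToSpine-index _ sv (step _ here) _ descending starts = trans (+-comm _ 1) (starts sv)
    spineToSpine-index {z} {v} sz sv (step {x = n} z~n wn@(step {x = n′} _ w′)) uq@(_ ∷ uq′) d starts
      with walk-head T w′
    ... | ys , refl = extend d (continuesAlongSpine d sz z~n wn uq starts)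
      where
      k = length (n′ ∷ ys)
      extend : ∀ d → Spine n × StartsIn d (n ∷ n′ ∷ ys) × Step d (index z) (index n) → IndexShift d z v (suc k)
      extend ascending (sn , starts′ , st) =
        trans (+-suc (index z) k) (trans (cong (_+ k) st) (spineToSpine-index sn sv wn uq′ ascending starts′))
      extend descending (sn , starts′ , st) =
        trans (+-suc (index v) k) (trans (cong suc (spineToSpine-index sn sv wn uq′ descending starts′)) st)

    private
      farApart-notConsecutive : ∀ {i j} k → i + suc (suc k) ≡ j → ¬ (suc i ≡ j ⊎ suc j ≡ i)
      farApart-notConsecutive {i} k far (inj₁ next) =
        m+1+n≢m i (suc-injective (trans (sym (+-suc i (suc k))) (trans far (sym next))))
      farApart-notConsecutive {i} k far (inj₂ prev) =
        m+1+n≢m i (trans (+-suc i (suc (suc k))) (trans (cong suc far) prev))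

    -- All nodes of a cycle lie on the spine, and along the cycle the index moves monotonically,
    -- so the closing edge would join two indices at distance at least 2.
    acyclic : ¬ HasCycle T
    acyclic (_ , _ , _ , (here , _) , s≤s () , _)
    acyclic (_ , _ , _ , (step _ here , _) , s≤s (s≤s ()) , _)
    acyclic (u , v , _ , (step {x = a} u~a wa@(step {x = b} _ w′) , uq@(u∉ ∷ a∉ ∷ _)) , _ , v~u) with walk-head T w′
    ... | ys , refl = closesFar (proj₁ (spineStep su sa u~a)) (λ _ → proj₂ (spineStep su sa u~a))
      where
      a≢v : a ≢ v
      a≢v refl = All.lookup a∉ (walk-last∈ T w′) refl
      su = twoNeighbours⇒spine u~a (edge-sym T v~u) a≢v
      sa = twoNeighbours⇒spine (edge-sym T u~a) (walk-firstEdge T wa) (All.lookup u∉ (there (here refl)))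
      sv : Spine v
      sv with penultimate T (walk-firstEdge T wa) w′
      ... | p , p~v , p∈ = twoNeighbours⇒spine (edge-sym T p~v) v~u (λ { refl → All.lookup u∉ p∈ refl })
      closesFar : ∀ d → StartsIn d (u ∷ a ∷ b ∷ ys) → ⊥
      closesFar ascending starts =
        farApart-notConsecutive _ (spineToSpine-index su sv (step u~a wa) uq ascending starts)
                                  (spineEdge-consecutive su sv (edge-sym T v~u))
      closesFar descending starts =
        farApart-notConsecutive _ (spineToSpine-index su sv (step u~a wa) uq descending starts)
                                  (spineEdge-consecutive sv su v~u)

    distAtMost1⇔ : Connected T → ∀ {x y} → ¬ Spine x → ¬ Spine y → x ≢ y →
                   DistAtMost1 T w x y ⇔ (hang x +ℚ hang y +ℚ ∣ foot x - foot y ∣ ≤ℚ 1ℚ)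
    distAtMost1⇔ connected ¬sx ¬sy x≢y = mk⇔
      (λ (xs , path , ≤1) → subst (_≤ℚ 1ℚ) (leafToLeaf-distance ¬sx ¬sy x≢y path) ≤1)
      (λ ≤1 → let xs , path = connected _ _ in xs , path , subst (_≤ℚ 1ℚ) (sym (leafToLeaf-distance ¬sx ¬sy x≢y path)) ≤1)

module LayoutOfCaterpillar where

  open import Data.Nat using (zero; suc; _+_; _≤_; _<_; z≤n; s≤s)
  open import Data.Nat.Properties using (+-suc; +-identityʳ; <-cmp; m≤n⇒∃[o]m+o≡n)
  open import Data.Bool using (true)
  open import Data.Bool.Properties using () renaming (_≟_ to _≟ᵇ_)
  open import Data.Fin using (Fin)
  open import Data.Fin.Properties using (_≟_; any?)
  open import Data.List using (List; []; _∷_; length)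
  open import Data.List.Membership.Propositional using (_∈_)
  open import Data.List.Relation.Unary.Any using (here; there)
  open import Data.List.Relation.Unary.All as All using ()
  open import Data.List.Relation.Unary.AllPairs using (_∷_)
  open import Data.List.Relation.Unary.Unique.Propositional using (Unique)
  open import Data.Product using (_×_; _,_; proj₁; proj₂)
  open import Data.Sum using (_⊎_; inj₁; inj₂)
  open import Data.Empty using (⊥-elim)
  open import Data.Rational using (ℚ; 0ℚ; ½; _-_; _*_) renaming (_+_ to _+ℚ_)
  open import Data.Rational.Solver using (module +-*-Solver)
  open import Relation.Binary using (tri<; tri≈; tri>)
  open import Relation.Binary.PropositionalEquality using (_≡_; _≢_; refl; cong; cong₂; subst; subst₂; sym; trans)
  open import Relation.Binary.PropositionalEquality.Properties using (module ≡-Reasoning)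
  open import Relation.Nullary using (¬_; Dec; yes; no)
  open import Relation.Nullary.Decidable using (_×-dec_; ¬?)
  open +-*-Solver
  open Walks
  open CaterpillarLayouts

  nth : ∀ {m} → Fin m → List (Fin m) → ℕ → Fin m
  nth d []       _       = d
  nth d (x ∷ xs) zero    = x
  nth d (x ∷ xs) (suc i) = nth d xs i

  indexOf : ∀ {m} → Fin m → List (Fin m) → ℕ
  indexOf x []       = 0
  indexOf x (y ∷ ys) with x ≟ y
  ... | yes _ = 0
  ... | no  _ = suc (indexOf x ys)

  nth-indexOf : ∀ {m} (d x : Fin m) xs → x ∈ xs → nth d xs (indexOf x xs) ≡ x × indexOf x xs < length xs
  nth-indexOf d x (y ∷ ys) x∈ with x ≟ y
  ... | yes refl = refl , s≤s z≤n
  ... | no  x≢y with x∈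
  ...   | here x≡y  = ⊥-elim (x≢y x≡y)
  ...   | there x∈′ = let eq , lt = nth-indexOf d x ys x∈′ in eq , s≤s lt

  nth-∈ : ∀ {m} (d : Fin m) xs t → t < length xs → nth d xs t ∈ xs
  nth-∈ d (x ∷ xs) zero    _        = here refl
  nth-∈ d (x ∷ xs) (suc t) (s≤s lt) = there (nth-∈ d xs t lt)

  nth-injective : ∀ {m} (d : Fin m) xs → Unique xs → ∀ t t′ → t < length xs → t′ < length xs →
                  nth d xs t ≡ nth d xs t′ → t ≡ t′
  nth-injective d (x ∷ xs) _        zero    zero     _        _         _  = refl
  nth-injective d (x ∷ xs) (x∉ ∷ _) zero    (suc t′) _        (s≤s lt′) eq = ⊥-elim (All.lookup x∉ (nth-∈ d xs t′ lt′) eq)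
  nth-injective d (x ∷ xs) (x∉ ∷ _) (suc t) zero     (s≤s lt) _         eq = ⊥-elim (All.lookup x∉ (nth-∈ d xs t lt) (sym eq))
  nth-injective d (x ∷ xs) (_ ∷ uq) (suc t) (suc t′) (s≤s lt) (s≤s lt′) eq = cong suc (nth-injective d xs uq t t′ lt lt′ eq)

  nth-edge : ∀ {m} {T : Graph m} (d : Fin m) {u v xs} → Walk T u v xs → ∀ t → suc t < length xs →
             Edge T (nth d xs t) (nth d xs (suc t))
  nth-edge d here       t       (s≤s ())
  nth-edge d (step e w) zero    _        with walk-head _ w
  ... | _ , refl = e
  nth-edge d (step e w) (suc t) (s≤s lt) = nth-edge d w t lt

  module _ {m : ℕ} (T : Graph m) (w : Fin m → Fin m → ℚ) (weighting : IsWeighting T w) where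

    Spine : Fin m → Set
    Spine = DegAtLeast2 T

    edge? : ∀ x y → Dec (Edge T x y)
    edge? x y = adj T x y ≟ᵇ true

    spine? : ∀ x → Dec (Spine x)
    spine? x = any? λ p → any? λ q → edge? x p ×-dec edge? x q ×-dec ¬? (p ≟ q)

    leaf-uniqueNeighbour : ∀ {x y z} → ¬ Spine x → Edge T x y → Edge T x z → y ≡ z
    leaf-uniqueNeighbour {y = y} {z} ¬sx x~y x~z with y ≟ z
    ... | yes y≡z = y≡z
    ... | no  y≢z = ⊥-elim (¬sx (y , z , x~y , x~z , y≢z))

    -- A leaf hangs at the full weight of its edge from a spine node; two adjacent leaves split their edge.
    module Hanging (position : Fin m → ℚ) where

      hangAt footAt : Fin m → Fin m → ℚ
      hangAt x y with spine? y
      ... | yes _ = w x y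
      ... | no  _ = w x y * ½
      footAt x y with spine? y
      ... | yes _ = position y
      ... | no  _ = 0ℚ

      hang foot : Fin m → ℚ
      hang x with any? (edge? x)
      ... | yes (y , _) = hangAt x y
      ... | no  _       = 0ℚ
      foot x with any? (edge? x)
      ... | yes (y , _) = footAt x y
      ... | no  _       = 0ℚ

      hang-fromSpine : ∀ {x s} → ¬ Spine x → Spine s → Edge T x s → w x s ≡ hang x × foot x ≡ position s
      hang-fromSpine {x} {s} ¬sx ss x~s with any? (edge? x)
      ... | no  ∄y = ⊥-elim (∄y (s , x~s))
      ... | yes (y , x~y) with leaf-uniqueNeighbour ¬sx x~y x~s
      ...   | refl with spine? y
      ...     | yes _  = refl , refl
      ...     | no ¬sy = ⊥-elim (¬sy ss)

      hang-fromLeaf : ∀ {x y} → ¬ Spine x → ¬ Spine y → Edge T x y → w x y ≡ hang x +ℚ hang y × foot x ≡ foot y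
      hang-fromLeaf {x} {y} ¬sx ¬sy x~y with any? (edge? x) | any? (edge? y)
      ... | no ∄x′ | _      = ⊥-elim (∄x′ (y , x~y))
      ... | yes _  | no ∄y′ = ⊥-elim (∄y′ (x , edge-sym T x~y))
      ... | yes (y′ , x~y′) | yes (x′ , y~x′)
        with leaf-uniqueNeighbour ¬sx x~y′ x~y | leaf-uniqueNeighbour ¬sy y~x′ (edge-sym T x~y)
      ...   | refl | refl with spine? y′ | spine? x′
      ...     | yes sy | _      = ⊥-elim (¬sy sy)
      ...     | no _   | yes sx = ⊥-elim (¬sx sx)
      ...     | no _   | no _   = trans (halves (w x y)) (cong (λ v → w x y * ½ +ℚ v * ½) (proj₁ weighting x y)) , refl
        where
        halves : ∀ z → z ≡ z * ½ +ℚ z * ½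
        halves = solve 1 (λ z → z := z :* con ½ :+ z :* con ½) refl

    layoutWithoutSpine : (∀ x → ¬ Spine x) → CaterpillarLayout T w
    layoutWithoutSpine noSpine = record
      { Spine = Spine ; spine? = spine? ; offSpine-isLeaf = λ _ ¬sx → ¬sx
      ; index = λ _ → 0 ; index-injective = λ sx _ _ → ⊥-elim (noSpine _ sx)
      ; spineEdge-consecutive = λ sx _ _ → ⊥-elim (noSpine _ sx)
      ; position = λ _ → 0ℚ ; spineEdge-weight = λ sx _ _ _ → ⊥-elim (noSpine _ sx)
      ; hang = hang ; foot = foot ; hang-fromSpine = hang-fromSpine ; hang-fromLeaf = hang-fromLeaf
      ; weight-sym = proj₁ weighting ; weight-nonNeg = λ x y x~y → proj₁ (proj₂ weighting x y x~y) }
      where open Hanging (λ _ → 0ℚ)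

    module AlongPath (acyclic : ¬ HasCycle T) {u v : Fin m} {xs : List (Fin m)} (path : IsPath T u v xs)
                     (covers : ∀ x → Spine x → x ∈ xs) where

      k : ℕ
      k = length xs

      s : ℕ → Fin m
      s = nth u xs

      open Segments T s k (nth-edge u (proj₁ path)) (nth-injective u xs (proj₂ path))
      open ≡-Reasoning

      index : Fin m → ℕ
      index x = indexOf x xs

      positionAt : ℕ → ℚ
      positionAt zero    = 0ℚ
      positionAt (suc i) = positionAt i +ℚ w (s i) (s (suc i))

      position : Fin m → ℚ
      position x = positionAt (index x)

      s-index : ∀ {x} → Spine x → s (index x) ≡ x × index x < k
      s-index {x} sx = nth-indexOf u x xs (covers x sx)

      noChord : ∀ i l → i + suc (suc l) < k → ¬ Edge T (s (i + suc (suc l))) (s i)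
      noChord i l lt chord = acyclic (s i , s (i + suc (suc l)) , segment i (suc (suc l)) ,
        (segment-walk i (suc (suc l)) lt , segment-unique i (suc (suc l)) lt) ,
        subst (3 ≤_) (sym (length-segment i (suc (suc l)))) (s≤s (s≤s (s≤s z≤n))) , chord)

      private
        consecutiveAbove : ∀ {i j} → i < j → j < k → Edge T (s j) (s i) → suc i ≡ j
        consecutiveAbove {i} {j} i<j j<k chord with m≤n⇒∃[o]m+o≡n i<j
        ... | zero  , eq = trans (sym (+-identityʳ (suc i))) eq
        ... | suc l , eq = ⊥-elim (noChord i l (subst (_< k) j≡ j<k) (subst (λ j → Edge T (s j) (s i)) j≡ chord))
          where
          j≡ : j ≡ i + suc (suc l)
          j≡ = sym (trans (+-suc i (suc l)) eq)

      pathEdge-consecutive : ∀ {i j} → i < k → j < k → Edge T (s i) (s j) → suc i ≡ j ⊎ suc j ≡ i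
      pathEdge-consecutive {i} {j} i<k j<k i~j with <-cmp i j
      ... | tri< i<j _ _ = inj₁ (consecutiveAbove i<j j<k (edge-sym T i~j))
      ... | tri≈ _ refl _ = ⊥-elim (edge-irrefl T i~j)
      ... | tri> _ _ j<i = inj₂ (consecutiveAbove j<i i<k i~j)

      spineEdge-weight : ∀ {x y} → Spine x → Spine y → Edge T x y → suc (index x) ≡ index y →
                         w x y ≡ position y - position x
      spineEdge-weight {x} {y} sx sy _ next = begin
        w x y                                                   ≡⟨ sym (cong₂ w (proj₁ (s-index sx)) s-next) ⟩
        w (s (index x)) (s (suc (index x)))                     ≡⟨ solve 2 (λ p q → q := p :+ q :- p) refl (position x) _ ⟩
        positionAt (suc (index x)) - position x                 ≡⟨ cong (λ i → positionAt i - position x) next ⟩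
        position y - position x                                 ∎
        where s-next = trans (cong s next) (proj₁ (s-index sy))

      layout : CaterpillarLayout T w
      layout = record
        { Spine = Spine ; spine? = spine? ; offSpine-isLeaf = λ _ ¬sx → ¬sx
        ; index = index
        ; index-injective = λ sx sy eq → trans (sym (proj₁ (s-index sx))) (trans (cong s eq) (proj₁ (s-index sy)))
        ; spineEdge-consecutive = λ sx sy x~y → pathEdge-consecutive (proj₂ (s-index sx)) (proj₂ (s-index sy))
            (subst₂ (Edge T) (sym (proj₁ (s-index sx))) (sym (proj₁ (s-index sy))) x~y)
        ; position = position ; spineEdge-weight = spineEdge-weight
        ; hang = hang ; foot = foot ; hang-fromSpine = hang-fromSpine ; hang-fromLeaf = hang-fromLeaf
        ; weight-sym = proj₁ weighting ; weight-nonNeg = λ x y x~y → proj₁ (proj₂ weighting x y x~y) }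
        where open Hanging position

module LinearLeafPowerToBlueRed where

  open import Data.Fin using (Fin)
  open import Data.Product using (Σ; _,_; proj₁; proj₂)
  open import Data.Sum using (inj₁; inj₂)
  open import Data.Rational using (ℚ; ½; _-_; _≤_; _+_)
  open import Data.Rational.Properties using (_≤?_; ≰⇒>)
  open import Data.Rational.Solver using (module +-*-Solver)
  open import Function.Base using (_∘_)
  open import Function.Properties.Equivalence using (⇔-setoid)
  open import Level using (0ℓ)
  open import Relation.Binary.Reasoning.Setoid (⇔-setoid 0ℓ)
  open import Relation.Binary.PropositionalEquality using (refl)
  open import Relation.Nullary using (¬_; Dec; yes; no; does)
  open +-*-Solver
  open RationalOrder
  open LeafIntervals
  open CaterpillarLayouts
  open LayoutOfCaterpillar using (layoutWithoutSpine; module AlongPath)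
  open import Data.List.Relation.Unary.Any.Properties using (¬Any[])

  radiusFor : ∀ a (d : Dec (a ≤ ½)) → Σ ℚ (IsRadius (does d) a)
  radiusFor a (yes a≤½) = ½ - a , solve 1 (λ a → a := con ½ :- (con ½ :- a)) refl a , p≤q⇒0≤q-p a≤½
  radiusFor a (no  a≰½) = a - ½ , solve 1 (λ a → a := con ½ :+ (a :- con ½)) refl a , p<q⇒0<q-p (≰⇒> a≰½)

  hangingInterval : (hang foot : ℚ) → LeafInterval
  hangingInterval a p = leafInterval (does (a ≤? ½)) a (proj₁ (radiusFor a (a ≤? ½))) p (proj₂ (radiusFor a (a ≤? ½)))

  module _ {n m : ℕ} (G : Graph n) {T : Graph m} {ι : Fin n → Fin m} {w : Fin m → Fin m → ℚ}
           (root : IsLeafRoot G T ι w) (L : CaterpillarLayout T w)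
           (leaf⇒offSpine : ∀ x → IsLeaf T x → ¬ CaterpillarLayout.Spine L x) where

    open CaterpillarLayout L
    open CaterpillarLayoutProperties L

    blueRed-ofLayout : IsBlueRedIntervalGraph G
    blueRed-ofLayout = LeafInterval.blue ∘ J , interval ∘ J , model
      where
      J : Fin n → LeafInterval
      J u = hangingInterval (hang (ι u)) (foot (ι u))
      tree = proj₁ root
      ι-injective = proj₁ (proj₂ root)
      leaves = proj₁ (proj₂ (proj₂ root))
      edge⇔dist = proj₂ (proj₂ (proj₂ (proj₂ root)))
      offSpine : ∀ u → ¬ Spine (ι u)
      offSpine u = leaf⇒offSpine (ι u) (Equivalence.from (leaves (ι u)) (u , refl))
      model : IsBlueRedModel G (LeafInterval.blue ∘ J) (interval ∘ J)
      model u v u≢v = begin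
        Edge G u v                   ≈⟨ edge⇔dist u v u≢v ⟩
        DistAtMost1 T w (ι u) (ι v)  ≈⟨ distAtMost1⇔ (proj₁ tree) (offSpine u) (offSpine v) (λ eq → u≢v (ι-injective u v eq)) ⟩
        WithinOne (J u) (J v)        ≈⟨ related⇔withinOne (J u) (J v) ⟨
        Related (J u) (J v)          ∎

  linearLeafPower⇒blueRed : ∀ {n} (G : Graph n) → IsLinearLeafPower G → IsBlueRedIntervalGraph G
  linearLeafPower⇒blueRed G (m , T , ι , w , root , (_ , _ , inj₁ refl , covers)) =
    blueRed-ofLayout G root (layoutWithoutSpine T w weighting (λ x sx → ¬Any[] (covers x sx))) (λ _ leaf → leaf)
    where weighting = proj₁ (proj₂ (proj₂ (proj₂ root)))
  linearLeafPower⇒blueRed G (m , T , ι , w , root , (_ , _ , inj₂ (_ , _ , path) , covers)) =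
    blueRed-ofLayout G root (AlongPath.layout T w weighting acyclic path covers) (λ _ leaf → leaf)
    where
    weighting = proj₁ (proj₂ (proj₂ (proj₂ root)))
    acyclic = proj₂ (proj₁ root)

module Ranks where

  open import Data.Nat using (suc; z≤n; s≤s) renaming (_≤_ to _≤ℕ_; _<_ to _<ℕ_)
  open import Data.Nat.Properties using (m≤n⇒m≤1+n) renaming (<⇒≱ to <⇒≱ℕ)
  open import Data.Rational using (ℚ; _≤_; _<_)
  open import Data.Rational.Properties using (_<?_; _≤?_; <-≤-trans; <⇒≤; <-irrefl; ≰⇒>)
  open import Data.List using (List; []; _∷_; length)
  open import Data.List.Membership.Propositional using (_∈_)
  open import Data.List.Relation.Unary.Any using (here; there)
  open import Data.Empty using (⊥-elim)
  open import Relation.Binary.PropositionalEquality using (refl)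
  open import Relation.Nullary using (¬_; yes; no)

  rank : ℚ → List ℚ → ℕ
  rank q []       = 0
  rank q (e ∷ es) with e <? q
  ... | yes _ = suc (rank q es)
  ... | no  _ = rank q es

  rank-mono : ∀ {q q′} es → q ≤ q′ → rank q es ≤ℕ rank q′ es
  rank-mono [] _ = z≤n
  rank-mono {q} {q′} (e ∷ es) q≤q′ with e <? q | e <? q′
  ... | yes _   | yes _    = s≤s (rank-mono es q≤q′)
  ... | yes e<q | no  e≮q′ = ⊥-elim (e≮q′ (<-≤-trans e<q q≤q′))
  ... | no  _   | yes _    = m≤n⇒m≤1+n (rank-mono es q≤q′)
  ... | no  _   | no  _    = rank-mono es q≤q′

  rank-bound : ∀ q es → rank q es ≤ℕ length es
  rank-bound q [] = z≤n
  rank-bound q (e ∷ es) with e <? q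
  ... | yes _ = s≤s (rank-bound q es)
  ... | no  _ = m≤n⇒m≤1+n (rank-bound q es)

  private
    rank-strict : ∀ {q q′ e} es → q ≤ q′ → e ∈ es → e < q′ → ¬ e < q → rank q es <ℕ rank q′ es
    rank-strict {q} {q′} (x ∷ xs) q≤q′ (here refl) e<q′ e≮q with x <? q | x <? q′
    ... | yes e<q | _        = ⊥-elim (e≮q e<q)
    ... | no  _   | yes _    = s≤s (rank-mono xs q≤q′)
    ... | no  _   | no  e≮q′ = ⊥-elim (e≮q′ e<q′)
    rank-strict {q} {q′} (x ∷ xs) q≤q′ (there e∈) e<q′ e≮q with x <? q | x <? q′
    ... | yes _   | yes _    = s≤s (rank-strict xs q≤q′ e∈ e<q′ e≮q)
    ... | yes x<q | no  x≮q′ = ⊥-elim (x≮q′ (<-≤-trans x<q q≤q′))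
    ... | no  _   | yes _    = m≤n⇒m≤1+n (rank-strict xs q≤q′ e∈ e<q′ e≮q)
    ... | no  _   | no  _    = rank-strict xs q≤q′ e∈ e<q′ e≮q

  ≤⇔rank≤ : ∀ {p q} es → q ∈ es → (p ≤ q) ⇔ (rank p es ≤ℕ rank q es)
  ≤⇔rank≤ {p} {q} es q∈ = mk⇔ (rank-mono es) from
    where
    from : rank p es ≤ℕ rank q es → p ≤ q
    from r≤r with p ≤? q
    ... | yes p≤q = p≤q
    ... | no  p≰q = ⊥-elim (<⇒≱ℕ (rank-strict es (<⇒≤ (≰⇒> p≰q)) q∈ (≰⇒> p≰q) (<-irrefl refl)) r≤r)

module NaturalsInℚ where

  open import Data.Nat using (zero; suc; _∸_) renaming (_+_ to _+ℕ_; _≤_ to _≤ℕ_; _<_ to _<ℕ_)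
  open import Data.Nat.Properties using (≤-<-connex; m≤n⇒∃[o]m+o≡n; m+[n∸m]≡n)
  open import Data.Rational using (ℚ; 0ℚ; 1ℚ; ½; _+_; _-_; _*_; -_; _≤_; _<_; Positive; NonNegative; NonZero; positive; 1/_)
  open import Data.Rational.Properties
  open import Data.Rational.Solver using (module +-*-Solver)
  open import Data.Product using (_,_)
  open import Data.Sum using (inj₁; inj₂)
  open import Data.Empty using (⊥-elim)
  open import Relation.Binary.PropositionalEquality using (_≡_; refl; cong; subst; subst₂; sym; trans)
  open +-*-Solver
  open RationalOrder

  fromℕ : ℕ → ℚ
  fromℕ zero    = 0ℚ
  fromℕ (suc k) = 1ℚ + fromℕ k

  fromℕ-+ : ∀ a b → fromℕ (a +ℕ b) ≡ fromℕ a + fromℕ b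
  fromℕ-+ zero    b = sym (+-identityˡ (fromℕ b))
  fromℕ-+ (suc a) b = trans (cong (1ℚ +_) (fromℕ-+ a b)) (sym (+-assoc 1ℚ (fromℕ a) (fromℕ b)))

  fromℕ-nonNeg : ∀ a → 0ℚ ≤ fromℕ a
  fromℕ-nonNeg zero    = ≤-refl
  fromℕ-nonNeg (suc a) = +-mono-≤ (<⇒≤ (positive⁻¹ 1ℚ)) (fromℕ-nonNeg a)

  fromℕ-suc-pos : ∀ a → 0ℚ < fromℕ (suc a)
  fromℕ-suc-pos a = +-mono-<-≤ (positive⁻¹ 1ℚ) (fromℕ-nonNeg a)

  fromℕ-mono : ∀ {a b} → a ≤ℕ b → fromℕ a ≤ fromℕ b
  fromℕ-mono {a} le with m≤n⇒∃[o]m+o≡n le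
  ... | o , refl = ≤-byDifference (fromℕ o)
    (trans (cong (_- fromℕ a) (fromℕ-+ a o)) (solve 2 (λ x y → (x :+ y) :- x := y) refl (fromℕ a) (fromℕ o)))
    (fromℕ-nonNeg o)

  fromℕ-∸ : ∀ {a b} → a ≤ℕ b → fromℕ (b ∸ a) ≡ fromℕ b - fromℕ a
  fromℕ-∸ {a} {b} le = trans (solve 2 (λ x y → y := (x :+ y) :- x) refl (fromℕ a) (fromℕ (b ∸ a)))
    (cong (_- fromℕ a) (trans (sym (fromℕ-+ a (b ∸ a))) (cong fromℕ (m+[n∸m]≡n le))))

  private
    twiceGap-pos : ∀ {a b} k → b <ℕ a → 0ℚ < k →
                   0ℚ < (fromℕ a - (fromℕ b + 1ℚ)) + (fromℕ a - (fromℕ b + 1ℚ)) + k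
    twiceGap-pos {a} {b} k b<a 0<k = +-mono-≤-< (+-mono-≤ gap gap) 0<k
      where gap = p≤q⇒0≤q-p (subst (_≤ fromℕ a) (+-comm 1ℚ (fromℕ b)) (fromℕ-mono b<a))

  ¼ : ℚ
  ¼ = ½ * ½

  twice-≤⇔ : ∀ a b c → (fromℕ a + fromℕ a + c ≤ fromℕ b + fromℕ b + c) ⇔ (a ≤ℕ b)
  twice-≤⇔ a b c = mk⇔ to (λ a≤b → +-monoˡ-≤ c (+-mono-≤ (fromℕ-mono a≤b) (fromℕ-mono a≤b)))
    where
    to : fromℕ a + fromℕ a + c ≤ fromℕ b + fromℕ b + c → a ≤ℕ b
    to h with ≤-<-connex a b
    ... | inj₁ a≤b = a≤b
    ... | inj₂ b<a = ⊥-elim (<⇒≱ (<-byDifference _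
      (solve 3 (λ x y c → (x :+ x :+ c) :- (y :+ y :+ c)
         := (x :- (y :+ con 1ℚ)) :+ (x :- (y :+ con 1ℚ)) :+ (con 1ℚ :+ con 1ℚ)) refl (fromℕ a) (fromℕ b) c)
      (twiceGap-pos (1ℚ + 1ℚ) b<a (positive⁻¹ (1ℚ + 1ℚ)))) h)

  widened-≤⇔ : ∀ a b → (fromℕ a + fromℕ a - ¼ ≤ fromℕ b + fromℕ b + ¼) ⇔ (a ≤ℕ b)
  widened-≤⇔ a b = mk⇔ to from
    where
    from : a ≤ℕ b → fromℕ a + fromℕ a - ¼ ≤ fromℕ b + fromℕ b + ¼
    from a≤b = ≤-byDifference ((fromℕ b - fromℕ a) + (fromℕ b - fromℕ a) + (¼ + ¼))
      (solve 3 (λ x y q → (y :+ y :+ q) :- (x :+ x :- q) := (y :- x) :+ (y :- x) :+ (q :+ q)) refl (fromℕ a) (fromℕ b) ¼)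
      (+-mono-≤ (+-mono-≤ d d) (<⇒≤ (positive⁻¹ (¼ + ¼))))
      where d = p≤q⇒0≤q-p (fromℕ-mono a≤b)
    to : fromℕ a + fromℕ a - ¼ ≤ fromℕ b + fromℕ b + ¼ → a ≤ℕ b
    to h with ≤-<-connex a b
    ... | inj₁ a≤b = a≤b
    ... | inj₂ b<a = ⊥-elim (<⇒≱ (<-byDifference _
      (solve 2 (λ x y → (x :+ x :- con ¼) :- (y :+ y :+ con ¼)
         := (x :- (y :+ con 1ℚ)) :+ (x :- (y :+ con 1ℚ)) :+ (con 1ℚ :+ con ½)) refl (fromℕ a) (fromℕ b))
      (twiceGap-pos (1ℚ + ½) b<a (positive⁻¹ (1ℚ + ½)))) h)

  y+y≤1⇒y≤½ : ∀ {y} → y + y ≤ 1ℚ → y ≤ ½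
  y+y≤1⇒y≤½ {y} h = ≤-byDifference ((1ℚ - (y + y)) * ½)
    (solve 1 (λ y → con ½ :- y := (con 1ℚ :- (y :+ y)) :* con ½) refl y)
    (subst (_≤ (1ℚ - (y + y)) * ½) (*-zeroˡ ½) (*-monoʳ-≤-nonNeg ½ (p≤q⇒0≤q-p h)))

  module Scale (N : ℕ) where

    private
      D : ℚ
      D = fromℕ (suc N)
      instance
        D-pos : Positive D
        D-pos = positive (fromℕ-suc-pos N)
        D-nonZero : NonZero D
        D-nonZero = pos⇒nonZero D

    ε : ℚ
    ε = 1/ D

    instance
      ε-positive : Positive ε
      ε-positive = 1/pos⇒pos D
      ε-nonNegative : NonNegative ε
      ε-nonNegative = pos⇒nonNeg ε

    0≤ε : 0ℚ ≤ ε
    0≤ε = nonNegative⁻¹ ε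

    private
      εD≡1 : ε * D ≡ 1ℚ
      εD≡1 = *-inverseˡ D

    ε*-≤⇔ : ∀ {x y} → (ε * x ≤ ε * y) ⇔ (x ≤ y)
    ε*-≤⇔ = mk⇔ (*-cancelˡ-≤-pos ε) (*-monoˡ-≤-nonNeg ε)

    ε≤1 : ε ≤ 1ℚ
    ε≤1 = subst₂ _≤_ (*-identityʳ ε) εD≡1
      (Equivalence.from ε*-≤⇔ (subst (_≤ D) (+-identityʳ 1ℚ) (+-monoʳ-≤ 1ℚ (fromℕ-nonNeg N))))

    ε[h+¼]≤½ : ∀ h → h +ℕ h ≤ℕ N → ε * (fromℕ h + ¼) ≤ ½
    ε[h+¼]≤½ h 2h≤N = y+y≤1⇒y≤½ (subst₂ _≤_ (*-distribˡ-+ ε (fromℕ h + ¼) (fromℕ h + ¼)) εD≡1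
      (Equivalence.from ε*-≤⇔ twice≤D))
      where
      twice≤D : (fromℕ h + ¼) + (fromℕ h + ¼) ≤ D
      twice≤D = begin
        (fromℕ h + ¼) + (fromℕ h + ¼)  ≡⟨ solve 1 (λ x → (x :+ con ¼) :+ (x :+ con ¼) := (x :+ x) :+ con ½) refl (fromℕ h) ⟩
        (fromℕ h + fromℕ h) + ½        ≡⟨ cong (_+ ½) (sym (fromℕ-+ h h)) ⟩
        fromℕ (h +ℕ h) + ½             ≤⟨ +-mono-≤ (fromℕ-mono 2h≤N) (<⇒≤ ½<1) ⟩
        fromℕ N + 1ℚ                   ≡⟨ +-comm (fromℕ N) 1ℚ ⟩
        D                              ∎
        where
        open ≤-Reasoning
        ½<1 : ½ < 1ℚ
        ½<1 = <-byDifference ½ (solve 0 (con 1ℚ :- con ½ := con ½) refl) (positive⁻¹ ½)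

-- The spine 0, 1, …, K sits at positions base + ε t, and vertex u hangs from spine node att u at weight
-- hang u.  The hypotheses on att give every spine node degree at least 2, so the leaves are the vertices.
module SpineCaterpillar
  (n K : ℕ) (att : Fin n → Fin (suc K)) (hang : Fin n → ℚ) (ε base : ℚ)
  (hang-nonNeg : ∀ u → 0ℚ ≤ℚ hang u) (hang≤1 : ∀ u → hang u ≤ℚ 1ℚ) (ε-nonNeg : 0ℚ ≤ℚ ε) (ε≤1 : ε ≤ℚ 1ℚ)
  (firstUsed : ∃ λ u → toℕ (att u) ≡ 0) (lastUsed : ∃ λ u → toℕ (att u) ≡ K)
  (twoVertices : K ≡ 0 → ∃₂ λ (u v : Fin n) → u ≢ v) where

  open import Data.Nat using (zero; _+_; _≡ᵇ_; _≤_; _<_; z≤n; s≤s)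
  open import Data.Nat.Properties
    using (≡ᵇ⇒≡; ≡⇒≡ᵇ; n<1+n; <-trans; ≤-pred; ≤-antisym; ≮⇒≥; n<1⇒n≡0; n≢0⇒n>0; m≢1+m+n; +-comm)
    renaming (_≟_ to _≟ℕ_; _<?_ to _<?ℕ_)
  open import Data.Bool using (Bool; true; false; _∨_)
  open import Data.Bool.Properties using (∨-comm; T-≡)
  open import Data.Fin using (zero; suc; fromℕ<; splitAt; join)
  open import Data.Fin.Properties using (toℕ-injective; toℕ-fromℕ<; toℕ<n; splitAt-join; join-splitAt)
  open import Data.List using ([]; _∷_)
  open import Data.List.Membership.Propositional using (_∈_)
  open import Data.Product using (_×_; _,_; proj₁; proj₂)
  open import Data.Sum using (_⊎_; inj₁; inj₂)
  open import Data.Sum.Properties using (inj₁-injective; inj₂-injective)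
  open import Data.Unit using (⊤; tt)
  open import Data.Empty using (⊥; ⊥-elim)
  open import Data.Rational using (_-_; _*_) renaming (_+_ to _+ℚ_)
  open import Data.Rational.Solver using (module +-*-Solver)
  open import Relation.Binary.PropositionalEquality using (refl; cong; subst; subst₂; sym; trans)
  open import Relation.Nullary using (¬_; Dec; yes; no)
  open +-*-Solver
  open Walks
  open CaterpillarLayouts
  open NaturalsInℚ using (fromℕ)

  Node : Set
  Node = Fin n ⊎ Fin (suc K)

  m : ℕ
  m = n + suc K

  node : Fin m → Node
  node = splitAt n

  ⌜_⌝ : Node → Fin m
  ⌜_⌝ = join n (suc K)

  node-injective : ∀ {x y} → node x ≡ node y → x ≡ y
  node-injective {x} {y} eq = trans (sym (join-splitAt n (suc K) x)) (trans (cong ⌜_⌝ eq) (join-splitAt n (suc K) y))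

  private
    ≡ᵇ-true⇒≡ : ∀ {a b} → (a ≡ᵇ b) ≡ true → a ≡ b
    ≡ᵇ-true⇒≡ {a} {b} eq = ≡ᵇ⇒≡ a b (Equivalence.from T-≡ eq)

    ≡⇒≡ᵇ-true : ∀ {a b} → a ≡ b → (a ≡ᵇ b) ≡ true
    ≡⇒≡ᵇ-true {a} {b} eq = Equivalence.to T-≡ (≡⇒≡ᵇ a b eq)

    1+a≡ᵇa : ∀ a → (suc a ≡ᵇ a) ≡ false
    1+a≡ᵇa zero    = refl
    1+a≡ᵇa (suc a) = 1+a≡ᵇa a

  follows : Fin (suc K) → Fin (suc K) → Bool
  follows t t′ = suc (toℕ t) ≡ᵇ toℕ t′

  adjacent : Node → Node → Bool
  adjacent (inj₁ _) (inj₁ _)  = false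
  adjacent (inj₁ u) (inj₂ t)  = toℕ (att u) ≡ᵇ toℕ t
  adjacent (inj₂ t) (inj₁ u)  = toℕ (att u) ≡ᵇ toℕ t
  adjacent (inj₂ t) (inj₂ t′) = follows t t′ ∨ follows t′ t

  adjacent-sym : ∀ a b → adjacent a b ≡ adjacent b a
  adjacent-sym (inj₁ _) (inj₁ _)  = refl
  adjacent-sym (inj₁ _) (inj₂ _)  = refl
  adjacent-sym (inj₂ _) (inj₁ _)  = refl
  adjacent-sym (inj₂ t) (inj₂ t′) = ∨-comm (follows t t′) (follows t′ t)

  adjacent-irrefl : ∀ a → adjacent a a ≡ false
  adjacent-irrefl (inj₁ _) = refl
  adjacent-irrefl (inj₂ t) rewrite 1+a≡ᵇa (toℕ t) = refl

  T : Graph m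
  T = record { adj = λ x y → adjacent (node x) (node y)
             ; sym = λ x y → adjacent-sym (node x) (node y)
             ; irrefl = λ x → adjacent-irrefl (node x) }

  edge⁺ : ∀ a b → adjacent a b ≡ true → Edge T ⌜ a ⌝ ⌜ b ⌝
  edge⁺ a b = subst₂ (λ a b → adjacent a b ≡ true) (sym (splitAt-join n (suc K) a)) (sym (splitAt-join n (suc K) b))

  weightOf : Node → Node → ℚ
  weightOf (inj₁ _) (inj₁ _) = 0ℚ
  weightOf (inj₁ u) (inj₂ _) = hang u
  weightOf (inj₂ _) (inj₁ u) = hang u
  weightOf (inj₂ _) (inj₂ _) = ε

  w : Fin m → Fin m → ℚ
  w x y = weightOf (node x) (node y)

  weightOf-sym : ∀ a b → weightOf a b ≡ weightOf b a
  weightOf-sym (inj₁ _) (inj₁ _) = refl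
  weightOf-sym (inj₁ _) (inj₂ _) = refl
  weightOf-sym (inj₂ _) (inj₁ _) = refl
  weightOf-sym (inj₂ _) (inj₂ _) = refl

  weightOf-bounds : ∀ a b → adjacent a b ≡ true → 0ℚ ≤ℚ weightOf a b × weightOf a b ≤ℚ 1ℚ
  weightOf-bounds (inj₁ _) (inj₁ _) ()
  weightOf-bounds (inj₁ u) (inj₂ _) _ = hang-nonNeg u , hang≤1 u
  weightOf-bounds (inj₂ _) (inj₁ u) _ = hang-nonNeg u , hang≤1 u
  weightOf-bounds (inj₂ _) (inj₂ _) _ = ε-nonNeg , ε≤1

  weighting : IsWeighting T w
  weighting = (λ x y → weightOf-sym (node x) (node y)) , (λ x y → weightOf-bounds (node x) (node y))

  IsSpineNode : Node → Set
  IsSpineNode (inj₁ _) = ⊥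
  IsSpineNode (inj₂ _) = ⊤

  indexOf : Node → ℕ
  indexOf (inj₁ _) = 0
  indexOf (inj₂ t) = toℕ t

  positionOf : Node → ℚ
  positionOf a = base +ℚ ε * fromℕ (indexOf a)

  hangOf footOf : Node → ℚ
  hangOf (inj₁ u) = hang u
  hangOf (inj₂ _) = 0ℚ
  footOf (inj₁ u) = positionOf (inj₂ (att u))
  footOf (inj₂ _) = 0ℚ

  leafNode-neighbour : ∀ u b → adjacent (inj₁ u) b ≡ true → b ≡ inj₂ (att u)
  leafNode-neighbour u (inj₁ _) ()
  leafNode-neighbour u (inj₂ t) eq = cong inj₂ (sym (toℕ-injective (≡ᵇ-true⇒≡ eq)))

  offSpine-uniqueNeighbour : ∀ a b c → ¬ IsSpineNode a → adjacent a b ≡ true → adjacent a c ≡ true → b ≡ c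
  offSpine-uniqueNeighbour (inj₁ u) b c _ a~b a~c = trans (leafNode-neighbour u b a~b) (sym (leafNode-neighbour u c a~c))
  offSpine-uniqueNeighbour (inj₂ _) b c ¬s _ _ = ⊥-elim (¬s tt)

  spineNode-injective : ∀ a b → IsSpineNode a → IsSpineNode b → indexOf a ≡ indexOf b → a ≡ b
  spineNode-injective (inj₂ t) (inj₂ t′) _ _ eq = cong inj₂ (toℕ-injective eq)

  spineAdjacent-consecutive : ∀ a b → IsSpineNode a → IsSpineNode b → adjacent a b ≡ true →
                              suc (indexOf a) ≡ indexOf b ⊎ suc (indexOf b) ≡ indexOf a
  spineAdjacent-consecutive (inj₂ t) (inj₂ t′) _ _ a~b with follows t t′ in eq
  ... | true  = inj₁ (≡ᵇ-true⇒≡ eq)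
  ... | false = inj₂ (≡ᵇ-true⇒≡ a~b)

  spineAdjacent-weight : ∀ a b → IsSpineNode a → IsSpineNode b → suc (indexOf a) ≡ indexOf b →
                         weightOf a b ≡ positionOf b - positionOf a
  spineAdjacent-weight (inj₂ t) (inj₂ t′) _ _ next = trans
    (solve 3 (λ b e i → e := (b :+ e :* (con 1ℚ :+ i)) :- (b :+ e :* i)) refl base ε (fromℕ (toℕ t)))
    (cong (λ i → base +ℚ ε * fromℕ i - positionOf (inj₂ t)) next)

  hang-fromSpineNode : ∀ a b → ¬ IsSpineNode a → IsSpineNode b → adjacent a b ≡ true →
                       weightOf a b ≡ hangOf a × footOf a ≡ positionOf b
  hang-fromSpineNode (inj₂ _) _ ¬s _ _ = ⊥-elim (¬s tt)
  hang-fromSpineNode (inj₁ u) b _ _ a~b with leafNode-neighbour u b a~b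
  ... | refl = refl , refl

  layout : CaterpillarLayout T w
  layout = record
    { Spine = λ x → IsSpineNode (node x)
    ; spine? = λ x → spineNode? (node x)
    ; offSpine-isLeaf = λ x ¬sx (p , q , x~p , x~q , p≢q) →
        p≢q (node-injective (offSpine-uniqueNeighbour (node x) (node p) (node q) ¬sx x~p x~q))
    ; index = λ x → indexOf (node x)
    ; index-injective = λ {x} {y} sx sy eq → node-injective (spineNode-injective (node x) (node y) sx sy eq)
    ; spineEdge-consecutive = λ {x} {y} → spineAdjacent-consecutive (node x) (node y)
    ; position = λ x → positionOf (node x)
    ; spineEdge-weight = λ {x} {y} sx sy _ → spineAdjacent-weight (node x) (node y) sx sy
    ; hang = λ x → hangOf (node x)
    ; foot = λ x → footOf (node x)
    ; hang-fromSpine = λ {x} {s} → hang-fromSpineNode (node x) (node s)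
    ; hang-fromLeaf = λ {x} {y} → leaves-notAdjacent (node x) (node y)
    ; weight-sym = proj₁ weighting
    ; weight-nonNeg = λ x y x~y → proj₁ (proj₂ weighting x y x~y) }
    where
    spineNode? : ∀ a → Dec (IsSpineNode a)
    spineNode? (inj₁ _) = no λ ()
    spineNode? (inj₂ _) = yes tt
    leaves-notAdjacent : ∀ a b → ¬ IsSpineNode a → ¬ IsSpineNode b → adjacent a b ≡ true →
                         weightOf a b ≡ hangOf a +ℚ hangOf b × footOf a ≡ footOf b
    leaves-notAdjacent (inj₁ _) (inj₁ _) _  _  ()
    leaves-notAdjacent (inj₁ _) (inj₂ _) _  ¬s _ = ⊥-elim (¬s tt)
    leaves-notAdjacent (inj₂ _) _        ¬s _  _ = ⊥-elim (¬s tt)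

  open CaterpillarLayoutProperties layout using (acyclic)

  ⌜⌝-injective : ∀ {a b} → ⌜ a ⌝ ≡ ⌜ b ⌝ → a ≡ b
  ⌜⌝-injective {a} {b} eq = trans (sym (splitAt-join n (suc K) a)) (trans (cong node eq) (splitAt-join n (suc K) b))

  spineAdjacent⁺ : ∀ t t′ → suc (toℕ t) ≡ toℕ t′ → adjacent (inj₂ t) (inj₂ t′) ≡ true
  spineAdjacent⁺ t t′ next = subst (λ b → b ∨ follows t′ t ≡ true) (sym (≡⇒≡ᵇ-true next)) refl

  leafAdjacent⁺ : ∀ t u → toℕ (att u) ≡ toℕ t → adjacent (inj₂ t) (inj₁ u) ≡ true
  leafAdjacent⁺ t u = ≡⇒≡ᵇ-true

  degree2⁺ : ∀ a b c → adjacent a b ≡ true → adjacent a c ≡ true → b ≢ c → DegAtLeast2 T ⌜ a ⌝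
  degree2⁺ a b c a~b a~c b≢c = _ , _ , edge⁺ a b a~b , edge⁺ a c a~c , λ eq → b≢c (⌜⌝-injective {b} {c} eq)

  -- Indices beyond K are sent to the junk spine node 0.
  clamp : ℕ → Fin (suc K)
  clamp j with j <?ℕ suc K
  ... | yes j<  = fromℕ< j<
  ... | no  _   = zero

  toℕ-clamp : ∀ {j} → j < suc K → toℕ (clamp j) ≡ j
  toℕ-clamp {j} j< with j <?ℕ suc K
  ... | yes j<′ = toℕ-fromℕ< j<′
  ... | no  j≮  = ⊥-elim (j≮ j<)

  spineAt : ℕ → Fin m
  spineAt j = ⌜ inj₂ (clamp j) ⌝

  spineAt-toℕ : ∀ t → spineAt (toℕ t) ≡ ⌜ inj₂ t ⌝
  spineAt-toℕ t = cong (λ t → ⌜ inj₂ t ⌝) (toℕ-injective (toℕ-clamp (toℕ<n t)))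

  spineAt-edge : ∀ j → suc j < suc K → Edge T (spineAt j) (spineAt (suc j))
  spineAt-edge j lt = edge⁺ (inj₂ (clamp j)) (inj₂ (clamp (suc j))) (spineAdjacent⁺ (clamp j) (clamp (suc j))
    (trans (cong suc (toℕ-clamp (<-trans (n<1+n j) lt))) (sym (toℕ-clamp lt))))

  spineAt-injective : ∀ j j′ → j < suc K → j′ < suc K → spineAt j ≡ spineAt j′ → j ≡ j′
  spineAt-injective j j′ j< j′< eq =
    trans (sym (toℕ-clamp j<)) (trans (cong toℕ (inj₂-injective (⌜⌝-injective eq))) (toℕ-clamp j′<))

  open Segments T spineAt (suc K) spineAt-edge spineAt-injective

  private
    anchor : ∀ a → ∃ λ j → j < suc K × ∃ (Walk T ⌜ a ⌝ (spineAt j))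
    anchor (inj₁ u) = toℕ (att u) , toℕ<n (att u) , _ ,
      step (edge-sym T (subst (λ y → Edge T y ⌜ inj₁ u ⌝) (sym (spineAt-toℕ (att u)))
                              (edge⁺ (inj₂ (att u)) (inj₁ u) (leafAdjacent⁺ (att u) u refl)))) here
    anchor (inj₂ t) = toℕ t , toℕ<n t , _ , subst (λ y → Walk T ⌜ inj₂ t ⌝ y (⌜ inj₂ t ⌝ ∷ [])) (sym (spineAt-toℕ t)) here

    toSpineStart : ∀ x → ∃ (Walk T x (spineAt 0))
    toSpineStart x with subst (λ y → ∃ λ j → j < suc K × ∃ (Walk T y (spineAt j))) (join-splitAt n (suc K) x) (anchor (node x))
    ... | j , j< , _ , x⇝j = walk-++ T x⇝j (proj₂ (walk-reverse T (segment-walk 0 j j<)))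

  connected : Connected T
  connected x y = walk⇒path T (proj₂ (walk-++ T (proj₂ (toSpineStart x)) (proj₂ (walk-reverse T (proj₂ (toSpineStart y))))))

  tree : IsTree T
  tree = connected , acyclic

  ⌜node⌝ : ∀ x → ⌜ node x ⌝ ≡ x
  ⌜node⌝ = join-splitAt n (suc K)

  node⌜⌝ : ∀ a → node ⌜ a ⌝ ≡ a
  node⌜⌝ = splitAt-join n (suc K)

  private
    spineAdjacent⁻ : ∀ t t′ → suc (toℕ t′) ≡ toℕ t → adjacent (inj₂ t) (inj₂ t′) ≡ true
    spineAdjacent⁻ t t′ prev = trans (adjacent-sym (inj₂ t) (inj₂ t′)) (spineAdjacent⁺ t′ t prev)

    singleSpineNode : K ≡ 0 → ∀ (t : Fin (suc K)) → toℕ t ≡ 0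
    singleSpineNode K≡0 t = n<1⇒n≡0 (subst (λ k → toℕ t < suc k) K≡0 (toℕ<n t))

  -- Every spine node has two neighbours: spine nodes on both sides, or at an end the vertex attached there.
  spineNode-degree2 : ∀ t → DegAtLeast2 T ⌜ inj₂ t ⌝
  spineNode-degree2 t with K ≟ℕ 0
  ... | yes K≡0 with twoVertices K≡0
  ...   | u , v , u≢v = degree2⁺ (inj₂ t) (inj₁ u) (inj₁ v) (leafAdjacent⁺ t u (same u)) (leafAdjacent⁺ t v (same v))
                          (λ eq → u≢v (inj₁-injective eq))
    where same : ∀ u → toℕ (att u) ≡ toℕ t
          same u = trans (singleSpineNode K≡0 (att u)) (sym (singleSpineNode K≡0 t))
  spineNode-degree2 t | no K≢0 with toℕ t in t≡
  ... | zero = degree2⁺ (inj₂ t) (inj₂ (clamp 1)) (inj₁ u₀) (spineAdjacent⁺ t (clamp 1) (trans (cong suc t≡) (sym (toℕ-clamp 1<))))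
                 (leafAdjacent⁺ t u₀ (trans (proj₂ firstUsed) (sym t≡))) (λ ())
    where
    u₀ = proj₁ firstUsed
    1< : 1 < suc K
    1< = s≤s (n≢0⇒n>0 K≢0)
  ... | suc i with suc (suc i) <?ℕ suc K
  ...   | yes 2+i< = degree2⁺ (inj₂ t) (inj₂ (clamp i)) (inj₂ (clamp (suc (suc i)))) below
                      (spineAdjacent⁺ t (clamp (suc (suc i))) (trans (cong suc t≡) (sym (toℕ-clamp 2+i<))))
                      (λ eq → m≢1+m+n i (trans (sym (toℕ-clamp i<))
                                (trans (cong toℕ (inj₂-injective eq)) (trans (toℕ-clamp 2+i<) (cong suc (+-comm 1 i))))))
    where
    i< : i < suc K
    i< = <-trans (n<1+n i) (<-trans (n<1+n (suc i)) 2+i<)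
    below = spineAdjacent⁻ t (clamp i) (trans (cong suc (toℕ-clamp i<)) (sym t≡))
  ...   | no 2+i≮ = degree2⁺ (inj₂ t) (inj₂ (clamp i)) (inj₁ u₁) below
                      (leafAdjacent⁺ t u₁ (trans (proj₂ lastUsed) (sym t≡K))) (λ ())
    where
    u₁ = proj₁ lastUsed
    i< : i < suc K
    i< = <-trans (n<1+n i) (subst (_< suc K) t≡ (toℕ<n t))
    below = spineAdjacent⁻ t (clamp i) (trans (cong suc (toℕ-clamp i<)) (sym t≡))
    t≡K : toℕ t ≡ K
    t≡K = ≤-antisym (≤-pred (toℕ<n t)) (subst (K ≤_) (sym t≡) (≤-pred (≮⇒≥ 2+i≮)))

  vertex : Fin n → Fin m
  vertex v = ⌜ inj₁ v ⌝

  vertex-offSpine : ∀ v → ¬ IsSpineNode (node (vertex v))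
  vertex-offSpine v s = subst IsSpineNode (node⌜⌝ (inj₁ v)) s

  isLeaf⇔vertex : ∀ x → IsLeaf T x ⇔ ∃ λ v → vertex v ≡ x
  isLeaf⇔vertex x = mk⇔ to (λ (v , v≡x) → subst (IsLeaf T) v≡x (CaterpillarLayout.offSpine-isLeaf layout (vertex v) (vertex-offSpine v)))
    where
    to : IsLeaf T x → ∃ λ v → vertex v ≡ x
    to leaf = fromNode (node x) (⌜node⌝ x)
      where
      fromNode : ∀ a → ⌜ a ⌝ ≡ x → ∃ λ v → vertex v ≡ x
      fromNode (inj₁ u) eq = u , eq
      fromNode (inj₂ t) eq = ⊥-elim (leaf (subst (DegAtLeast2 T) eq (spineNode-degree2 t)))

  caterpillar : IsCaterpillar T
  caterpillar = tree , segment 0 K , inj₂ (spineAt 0 , spineAt K , segment-walk 0 K (n<1+n K) , segment-unique 0 K (n<1+n K)) , covers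
    where
    covers : ∀ x → DegAtLeast2 T x → x ∈ segment 0 K
    covers x deg = onSpine (node x) (⌜node⌝ x)
      where
      onSpine : ∀ a → ⌜ a ⌝ ≡ x → x ∈ segment 0 K
      onSpine (inj₁ u) eq = ⊥-elim (CaterpillarLayout.offSpine-isLeaf layout (vertex u) (vertex-offSpine u)
                                      (subst (DegAtLeast2 T) (sym eq) deg))
      onSpine (inj₂ t) eq = subst (_∈ segment 0 K) (trans (spineAt-toℕ t) eq) (∈-segment⁺ 0 K (toℕ t) z≤n (≤-pred (toℕ<n t)))

  vertex-hang : ∀ v → hangOf (node (vertex v)) ≡ hang v
  vertex-hang v = cong hangOf (node⌜⌝ (inj₁ v))

  vertex-foot : ∀ v → footOf (node (vertex v)) ≡ base +ℚ ε * fromℕ (toℕ (att v))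
  vertex-foot v = cong footOf (node⌜⌝ (inj₁ v))

  vertex-injective : ∀ u v → vertex u ≡ vertex v → u ≡ v
  vertex-injective u v eq = inj₁-injective (⌜⌝-injective {inj₁ u} {inj₁ v} eq)

module RankNormalisation {n : ℕ} (I : Fin n → Interval) where

  open import Data.Nat using (_+_; _≤_)

  open import Data.List using (List; map; allFin; _++_; length)
  open import Data.List.Properties using (length-++; length-map; length-tabulate)
  open import Data.List.Membership.Propositional using (_∈_)
  open import Data.List.Membership.Propositional.Properties using (∈-allFin; ∈-map⁺; ∈-++⁺ˡ; ∈-++⁺ʳ)
  open import Data.Rational using (_*_; -_) renaming (_+_ to _+ℚ_)
  open import Data.Product using (_×_)
  open import Function.Base using (_∘_)
  open import Function.Properties.Equivalence using (⇔-setoid)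
  open import Level using (0ℓ)
  open import Relation.Binary.PropositionalEquality using (cong₂; subst; subst₂; sym; trans)
  open import Relation.Binary.Reasoning.Setoid (⇔-setoid 0ℓ)
  open import Data.Product.Function.NonDependent.Propositional using (_×-⇔_)
  open Intervals
  open Ranks
  open NaturalsInℚ

  endpoints : List ℚ
  endpoints = map (lo ∘ I) (allFin n) ++ map (hi ∘ I) (allFin n)

  lo∈ : ∀ v → lo (I v) ∈ endpoints
  lo∈ v = ∈-++⁺ˡ (∈-map⁺ (lo ∘ I) (∈-allFin v))

  hi∈ : ∀ v → hi (I v) ∈ endpoints
  hi∈ v = ∈-++⁺ʳ (map (lo ∘ I) (allFin n)) (∈-map⁺ (hi ∘ I) (∈-allFin v))

  length-endpoints : length endpoints ≡ n + n
  length-endpoints = trans (length-++ (map (lo ∘ I) (allFin n))) (cong₂ _+_ (length-values (lo ∘ I)) (length-values (hi ∘ I)))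
    where
    length-values : (f : Fin n → ℚ) → length (map f (allFin n)) ≡ n
    length-values f = trans (length-map f (allFin n)) (length-tabulate {n = n} (λ v → v))

  L R : Fin n → ℕ
  L v = rank (lo (I v)) endpoints
  R v = rank (hi (I v)) endpoints

  L≤R : ∀ v → L v ≤ R v
  L≤R v = rank-mono endpoints (lo≤hi (I v))

  R≤2n : ∀ v → R v ≤ n + n
  R≤2n v = subst (R v ≤_) length-endpoints (rank-bound _ endpoints)

  module ScaledRelations (ε : ℚ) (ε*-≤⇔ : ∀ {x y} → (ε * x ≤ℚ ε * y) ⇔ (x ≤ℚ y)) (J : Fin n → Interval)
    (lo-J : ∀ v → lo (J v) ≡ ε * (fromℕ (L v) +ℚ fromℕ (L v) +ℚ - ¼))
    (hi-J : ∀ v → hi (J v) ≡ ε * (fromℕ (R v) +ℚ fromℕ (R v) +ℚ ¼)) where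

    private
      ≡⇒≤⇔ : ∀ {a b a′ b′} → a ≡ a′ → b ≡ b′ → (a ≤ℚ b) ⇔ (a′ ≤ℚ b′)
      ≡⇒≤⇔ a≡ b≡ = mk⇔ (subst₂ _≤ℚ_ a≡ b≡) (subst₂ _≤ℚ_ (sym a≡) (sym b≡))

      lo≤hi⇔ : ∀ u v → (lo (I u) ≤ℚ hi (I v)) ⇔ (lo (J u) ≤ℚ hi (J v))
      lo≤hi⇔ u v = begin
        lo (I u) ≤ℚ hi (I v)   ≈⟨ ≤⇔rank≤ endpoints (hi∈ v) ⟩
        L u ≤ R v              ≈⟨ widened-≤⇔ (L u) (R v) ⟨
        _                      ≈⟨ ε*-≤⇔ ⟨
        _                      ≈⟨ ≡⇒≤⇔ (sym (lo-J u)) (sym (hi-J v)) ⟩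
        lo (J u) ≤ℚ hi (J v)   ∎

      lo≤lo⇔ : ∀ u v → (lo (I u) ≤ℚ lo (I v)) ⇔ (lo (J u) ≤ℚ lo (J v))
      lo≤lo⇔ u v = begin
        lo (I u) ≤ℚ lo (I v)   ≈⟨ ≤⇔rank≤ endpoints (lo∈ v) ⟩
        L u ≤ L v              ≈⟨ twice-≤⇔ (L u) (L v) (- ¼) ⟨
        _                      ≈⟨ ε*-≤⇔ ⟨
        _                      ≈⟨ ≡⇒≤⇔ (sym (lo-J u)) (sym (lo-J v)) ⟩
        lo (J u) ≤ℚ lo (J v)   ∎

      hi≤hi⇔ : ∀ u v → (hi (I u) ≤ℚ hi (I v)) ⇔ (hi (J u) ≤ℚ hi (J v))
      hi≤hi⇔ u v = begin
        hi (I u) ≤ℚ hi (I v)   ≈⟨ ≤⇔rank≤ endpoints (hi∈ v) ⟩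
        R u ≤ R v              ≈⟨ twice-≤⇔ (R u) (R v) ¼ ⟨
        _                      ≈⟨ ε*-≤⇔ ⟨
        _                      ≈⟨ ≡⇒≤⇔ (sym (hi-J u)) (sym (hi-J v)) ⟩
        hi (J u) ≤ℚ hi (J v)   ∎

    meets⇔meets : ∀ u v → Meets (I u) (I v) ⇔ Meets (J u) (J v)
    meets⇔meets u v = begin
      Meets (I u) (I v)                              ≈⟨ meets⇔ (I u) (I v) ⟩
      (lo (I u) ≤ℚ hi (I v) × lo (I v) ≤ℚ hi (I u))  ≈⟨ lo≤hi⇔ u v ×-⇔ lo≤hi⇔ v u ⟩
      (lo (J u) ≤ℚ hi (J v) × lo (J v) ≤ℚ hi (J u))  ≈⟨ meets⇔ (J u) (J v) ⟨
      Meets (J u) (J v)                              ∎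

    ⊆ᴵ⇔⊆ᴵ : ∀ u v → I u ⊆ᴵ I v ⇔ J u ⊆ᴵ J v
    ⊆ᴵ⇔⊆ᴵ u v = begin
      I u ⊆ᴵ I v                                     ≈⟨ ⊆ᴵ⇔ (I u) (I v) ⟩
      (lo (I v) ≤ℚ lo (I u) × hi (I u) ≤ℚ hi (I v))  ≈⟨ lo≤lo⇔ v u ×-⇔ hi≤hi⇔ u v ⟩
      (lo (J v) ≤ℚ lo (J u) × hi (J u) ≤ℚ hi (J v))  ≈⟨ ⊆ᴵ⇔ (J u) (J v) ⟨
      J u ⊆ᴵ J v                                     ∎

module BlueRedToLinearLeafPower where

  open import Data.Nat using (zero; _+_; _∸_; _≤_; s≤s)
  open import Data.Nat.Properties using (∸-monoˡ-≤; m∸n≤m; n∸n≡0; m+[n∸m]≡n; ≤-trans) renaming (+-mono-≤ to +-mono-≤ℕ)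
  open import Data.Bool using (Bool; true; false)
  open import Data.Fin using (zero; suc; fromℕ<)
  open import Data.Fin.Properties using (toℕ-fromℕ<)
  open import Data.List using ([]; _∷_; allFin)
  open import Data.List.Relation.Unary.AllPairs using ([]; _∷_)
  open import Data.List.Extrema.Nat using (argmin; argmax; f[argmin]≤f[xs]; f[xs]≤f[argmax])
  open import Data.List.Membership.Propositional.Properties using (∈-allFin)
  open import Data.List.Relation.Unary.All as All using ([]; _∷_)
  open import Data.Product using (_×_; _,_; proj₁; proj₂)
  open import Data.Sum using (inj₁)
  open import Data.Empty using (⊥-elim)
  open import Data.Rational using (½; _-_; _*_; -_; ∣_∣; _<_) renaming (_+_ to _+ℚ_)
  open import Data.Rational.Properties
    using (<⇒≤; *-zeroʳ; *-monoʳ-<-pos; positive⁻¹; +-mono-≤; +-mono-<-≤; *-distribˡ-+)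
    renaming (+-comm to +ℚ-comm)
  open import Data.Rational.Solver using (module +-*-Solver)
  open import Function.Properties.Equivalence using (⇔-setoid)
  open import Level using (0ℓ)
  open import Relation.Binary.PropositionalEquality using (refl; cong; cong₂; subst; sym; trans)
  open import Relation.Binary.PropositionalEquality.Properties using (module ≡-Reasoning)
  import Relation.Binary.Reasoning.Setoid
  open import Function.Base using (_∘_)
  open +-*-Solver
  open RationalOrder
  open Intervals
  open LeafIntervals
  open CaterpillarLayouts
  open NaturalsInℚ

  edgelessRoot : ∀ {n} (G : Graph n) → (∀ (u v : Fin n) → u ≡ v) → IsLinearLeafPower G
  edgelessRoot {n} G subsingleton = n , T₀ , (λ v → v) , (λ _ _ → 0ℚ) ,
    (tree , (λ _ _ eq → eq) , (λ x → mk⇔ (λ _ → x , refl) (λ { _ (_ , _ , () , _) })) ,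
     ((λ _ _ → refl) , λ { _ _ () }) , (λ u v u≢v → ⊥-elim (u≢v (subsingleton u v)))) ,
    tree , [] , inj₁ refl , λ { _ (_ , _ , () , _) }
    where
    T₀ : Graph n
    T₀ = record { adj = λ _ _ → false ; sym = λ _ _ → refl ; irrefl = λ _ → refl }
    tree : IsTree T₀
    tree = (λ u v → _ , subst (λ y → IsPath T₀ u y (u ∷ [])) (subsingleton u v) (here , [] ∷ [])) ,
           λ { (_ , _ , _ , (here , _) , s≤s () , _) ; (_ , _ , _ , (step () _ , _) , _) }

  extremes : ∀ {k} (f : Fin (suc k) → ℕ) → ∃₂ λ v₀ v₁ → (∀ u → f v₀ ≤ f u) × (∀ u → f u ≤ f v₁)
  extremes f = argmin f zero (allFin _) , argmax f zero (allFin _) ,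
    (λ u → All.lookup (f[argmin]≤f[xs] {f = f} zero (allFin _)) (∈-allFin u)) ,
    (λ u → All.lookup (f[xs]≤f[argmax] {f = f} zero (allFin _)) (∈-allFin u))

  hangFor : Bool → ℚ → ℚ
  hangFor true  h = ½ - h
  hangFor false h = ½ +ℚ h

  hangFor-isRadius : ∀ b {h} → 0ℚ < h → IsRadius b (hangFor b h) h
  hangFor-isRadius true  0<h = refl , <⇒≤ 0<h
  hangFor-isRadius false 0<h = refl , 0<h

  hangFor-bounds : ∀ b {h} → 0ℚ ≤ℚ h → h ≤ℚ ½ → 0ℚ ≤ℚ hangFor b h × hangFor b h ≤ℚ 1ℚ
  hangFor-bounds true  {h} 0≤h h≤½ = p≤q⇒0≤q-p h≤½ ,
    ≤-byDifference (½ +ℚ h) (solve 1 (λ h → con 1ℚ :- (con ½ :- h) := con ½ :+ h) refl h)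
                   (+-mono-≤ (<⇒≤ (positive⁻¹ ½)) 0≤h)
  hangFor-bounds false {h} 0≤h h≤½ = +-mono-≤ (<⇒≤ (positive⁻¹ ½)) 0≤h ,
    ≤-byDifference (½ - h) (solve 1 (λ h → con 1ℚ :- (con ½ :+ h) := con ½ :- h) refl h) (p≤q⇒0≤q-p h≤½)

  module _ {n′ : ℕ} (G : Graph (suc (suc n′))) (blue : Fin (suc (suc n′)) → Bool)
           (I : Fin (suc (suc n′)) → Interval) (model : IsBlueRedModel G blue I) where

    private
      n : ℕ
      n = suc (suc n′)

    open RankNormalisation I
    -- ε = 1/(4n + 1) keeps every radius below ½, as R − L ≤ 2n.
    open Scale ((n + n) + (n + n))

    C : Fin n → ℕ
    C v = L v + R v

    -- Rank-normalised intervals [ε (2 L − ¼), ε (2 R + ¼)], written with centre and radius.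
    centre radius : Fin n → ℚ
    centre v = ε * fromℕ (C v)
    radius v = ε * (fromℕ (R v ∸ L v) +ℚ ¼)

    radius-pos : ∀ v → 0ℚ < radius v
    radius-pos v = subst (_< radius v) (*-zeroʳ ε) (*-monoʳ-<-pos ε
      (subst (0ℚ <_) (+ℚ-comm ¼ (fromℕ (R v ∸ L v))) (+-mono-<-≤ (positive⁻¹ ¼) (fromℕ-nonNeg (R v ∸ L v)))))

    radius≤½ : ∀ v → radius v ≤ℚ ½
    radius≤½ v = ε[h+¼]≤½ (R v ∸ L v) (+-mono-≤ℕ spread≤ spread≤)
      where spread≤ = ≤-trans (m∸n≤m (R v) (L v)) (R≤2n v)

    J : Fin n → LeafInterval
    J v = leafInterval (blue v) (hangFor (blue v) (radius v)) (radius v) (centre v) (hangFor-isRadius (blue v) (radius-pos v))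

    lo-J : ∀ v → lo (interval (J v)) ≡ ε * (fromℕ (L v) +ℚ fromℕ (L v) +ℚ - ¼)
    lo-J v = trans (cong₂ (λ c h → ε * c - ε * (h +ℚ ¼)) (fromℕ-+ (L v) (R v)) (fromℕ-∸ (L≤R v)))
      (solve 3 (λ e l r → e :* (l :+ r) :- e :* ((r :- l) :+ con ¼) := e :* (l :+ l :+ :- con ¼)) refl ε (fromℕ (L v)) (fromℕ (R v)))

    hi-J : ∀ v → hi (interval (J v)) ≡ ε * (fromℕ (R v) +ℚ fromℕ (R v) +ℚ ¼)
    hi-J v = trans (cong₂ (λ c h → ε * c +ℚ ε * (h +ℚ ¼)) (fromℕ-+ (L v) (R v)) (fromℕ-∸ (L≤R v)))
      (solve 3 (λ e l r → e :* (l :+ r) :+ e :* ((r :- l) :+ con ¼) := e :* (r :+ r :+ con ¼)) refl ε (fromℕ (L v)) (fromℕ (R v)))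

    module _ (v₀ v₁ : Fin n) (C-min : ∀ u → C v₀ ≤ C u) (C-max : ∀ u → C u ≤ C v₁) where

      K : ℕ
      K = C v₁ ∸ C v₀

      att : Fin n → Fin (suc K)
      att v = fromℕ< (s≤s (∸-monoˡ-≤ (C v₀) (C-max v)))

      toℕ-att : ∀ v → toℕ (att v) ≡ C v ∸ C v₀
      toℕ-att v = toℕ-fromℕ< _

      open SpineCaterpillar n K att (λ v → hangFor (blue v) (radius v)) ε (ε * fromℕ (C v₀))
        (λ v → proj₁ (hangFor-bounds (blue v) (<⇒≤ (radius-pos v)) (radius≤½ v)))
        (λ v → proj₂ (hangFor-bounds (blue v) (<⇒≤ (radius-pos v)) (radius≤½ v)))
        0≤ε ε≤1 (v₀ , trans (toℕ-att v₀) (n∸n≡0 (C v₀))) (v₁ , toℕ-att v₁) (λ _ → zero , suc zero , λ ())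
      open CaterpillarLayoutProperties layout using (distAtMost1⇔)

      vertex-foot≡centre : ∀ v → footOf (node (vertex v)) ≡ centre v
      vertex-foot≡centre v = begin
        footOf (node (vertex v))                       ≡⟨ vertex-foot v ⟩
        ε * fromℕ (C v₀) +ℚ ε * fromℕ (toℕ (att v))    ≡⟨ cong (λ k → ε * fromℕ (C v₀) +ℚ ε * fromℕ k) (toℕ-att v) ⟩
        ε * fromℕ (C v₀) +ℚ ε * fromℕ (C v ∸ C v₀)     ≡⟨ sym (*-distribˡ-+ ε _ _) ⟩
        ε * (fromℕ (C v₀) +ℚ fromℕ (C v ∸ C v₀))       ≡⟨ cong (ε *_) (sym (fromℕ-+ (C v₀) _)) ⟩
        ε * fromℕ (C v₀ + (C v ∸ C v₀))                ≡⟨ cong (λ k → ε * fromℕ k) (m+[n∸m]≡n (C-min v)) ⟩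
        centre v                                       ∎
        where open ≡-Reasoning

      private
        LayoutDistance : Fin n → Fin n → ℚ
        LayoutDistance u v = hangOf (node (vertex u)) +ℚ hangOf (node (vertex v))
                             +ℚ ∣ footOf (node (vertex u)) - footOf (node (vertex v)) ∣

        layoutDistance≡ : ∀ u v → LayoutDistance u v
                          ≡ LeafInterval.weight (J u) +ℚ LeafInterval.weight (J v) +ℚ ∣ centre u - centre v ∣
        layoutDistance≡ u v = cong₂ _+ℚ_ (cong₂ _+ℚ_ (vertex-hang u) (vertex-hang v))
                                         (cong₂ (λ p q → ∣ p - q ∣) (vertex-foot≡centre u) (vertex-foot≡centre v))

      edge⇔distance : ∀ u v → u ≢ v → Edge G u v ⇔ DistAtMost1 T w (vertex u) (vertex v)
      edge⇔distance u v u≢v = begin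
        Edge G u v                                    ≈⟨ model u v u≢v ⟩
        BlueRedRelated (blue u) (blue v) (I u) (I v)  ≈⟨ blueRedRelated-cong {blue u} {blue v} {I u} {I v} {interval (J u)} {interval (J v)}
                                                         (meets⇔meets u v) (⊆ᴵ⇔⊆ᴵ u v) (⊆ᴵ⇔⊆ᴵ v u) ⟩
        Related (J u) (J v)                           ≈⟨ related⇔withinOne (J u) (J v) ⟩
        WithinOne (J u) (J v)                         ≈⟨ mk⇔ (subst (_≤ℚ 1ℚ) (sym (layoutDistance≡ u v)))
                                                             (subst (_≤ℚ 1ℚ) (layoutDistance≡ u v)) ⟩
        LayoutDistance u v ≤ℚ 1ℚ                      ≈⟨ distAtMost1⇔ connected (vertex-offSpine u) (vertex-offSpine v)
                                                           (λ eq → u≢v (vertex-injective u v eq)) ⟨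
        DistAtMost1 T w (vertex u) (vertex v)         ∎
        where
        open Relation.Binary.Reasoning.Setoid (⇔-setoid 0ℓ)
        open RankNormalisation.ScaledRelations I ε ε*-≤⇔ (interval ∘ J) lo-J hi-J

      blueRed⇒linearLeafPower-≥2 : IsLinearLeafPower G
      blueRed⇒linearLeafPower-≥2 = m , T , vertex , w ,
        (tree , vertex-injective , isLeaf⇔vertex , weighting , edge⇔distance) , caterpillar

  -- With fewer than two vertices the single spine node would be a leaf, so the edgeless tree is used instead.
  blueRed⇒linearLeafPower : ∀ {n} (G : Graph n) → IsBlueRedIntervalGraph G → IsLinearLeafPower G
  blueRed⇒linearLeafPower {zero}        G _                    = edgelessRoot G λ ()
  blueRed⇒linearLeafPower {suc zero}    G _                    = edgelessRoot G λ { zero zero → refl }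
  blueRed⇒linearLeafPower {suc (suc _)} G (blue , I , model) =
    let v₀ , v₁ , C-min , C-max = extremes (C G blue I model)
    in  blueRed⇒linearLeafPower-≥2 G blue I model v₀ v₁ C-min C-max

theorem1 : (n : ℕ) (G : Graph n) → IsBlueRedIntervalGraph G ⇔ IsLinearLeafPower G
theorem1 n G = mk⇔ (BlueRedToLinearLeafPower.blueRed⇒linearLeafPower G)
                   (LinearLeafPowerToBlueRed.linearLeafPower⇒blueRed G)
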